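{- The QCNFs $\mathtt{Equality}_n$ have polynomial-size $\mathsf{QCDCL}^{\textsf{ASS-R-ORD}}_{\textsf{RED}}$ refutations.
   Context: $\mathtt{Equality}_n$ is the QCNF $\exists x_1\dots x_n\,\forall u_1\dots u_n\,\exists t_1\dots t_n\cdot(\bar t_1\vee\dots\vee\bar t_n)\wedge\bigwedge_{i=1}^n\big((\bar x_i\vee\bar u_i\vee t_i)\wedge(x_i\vee u_i\vee t_i)\big)$. Notions. For a QCNF $\Phi=\mathcal{Q}\cdot\phi$ with prefix $Q_1X_1\dots Q_sX_s$, $\mathrm{lv}(x)=i$ if the variable of $x$ is in $X_i$. $\mathrm{red}(C)$ deletes from $C$ every universal literal $v$ with $\mathrm{lv}(v)>\mathrm{lv}(x)$ for all existential $x\in C$; $(C_1\vee\ell)\otimes_\ell(C_2\vee\bar\ell)=C_1\vee C_2$ for existential $\ell$. $C|_\sigma=\top$ if $C\cap\sigma\neq\emptyset$, else the clause of $\ell\in C$ with $\bar\ell\notin\sigma$. A trail is $\mathcal{T}=(p_{(0,1)},\dots,p_{(0,g_0)};d_1,p_{(1,1)},\dots;\dots;d_r,\dots,p_{(r,g_r)})$, a sequence of literals with no variable occurring twice; $d_i$ decisions, $p_{(i,j)}$ propagated literals (existential, or $\bot$ only as last element: a conflict); $\mathcal{T}[s,t]$ is the initial segment ending at $p_{(s,t)}$ (at $d_s$ if $t=0$; $\mathcal{T}[0,0]$ empty); $|\mathcal{T}|$ its length. RED: each $p_{(i,j)}$ has antecedent $\mathrm{ante}(p_{(i,j)})$ in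 the current clause set with $\mathrm{red}(\mathrm{ante}(p_{(i,j)})|_{\mathcal{T}[i,j-1]})=(p_{(i,j)})$ ($(\bot)$ = empty clause). ASS-R-ORD: an existential literal $x$ may be decided only if every universal variable $u$ with $\mathrm{lv}(u)<\mathrm{lv}(x)$ has already been decided (universal decisions unrestricted). A clause is unit if its reduct is $(x)$ with $x$ existential or empty. Natural condition at an initial segment without $\bot$: if some clauses are unit under it, the next element is the literal of one of them with that clause as antecedent, and is $\bot$ if possible. Learnable clauses of a trail ending in $\bot$: start with $\mathrm{red}(\mathrm{ante}(\bot))$, go leftwards over propagated $p$: current $C'$ becomes $\mathrm{red}(C'\otimes_p\mathrm{red}(\mathrm{ante}(p)))$ if $\bar p\in C'$, else stays; $\mathcal{L}_\mathcal{T}$ is this sequence. A $\mathsf{QCDCL}^{\textsf{ASS-R-ORD}}_{\textsf{RED}}$ refutation of $\Phi$: trails $\mathcal{T}_1,\dots,\mathcal{T}_m$ and clauses $C_1,\dots,C_m=(\bot)$ (with derivations), $\mathcal{T}_i$ an ASS-R-ORD/RED trail for $\mathcal{Q}\cdot(\phi\cup\{C_1,\dots,C_{i-1}\})$ that has run into a conflict, $C_i\in\mathcal{L}_{\mathcal{T}_i}$, $\mathcal{T}_1$ satisfies the natural condition everywhere, and for $i\ge2$ some $(s,t)$ has $\mathcal{T}_i[s,t]=\mathcal{T}_{i-1}[s,t]$ with the natural condition for $\mathcal{T}_i$ at all initial segments extending $\mathcal{T}_i[s,t]$. Size $=\sum_i|\mathcal{T}_i|$. -}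

module Defs where

open import Data.Nat using (ℕ; zero; suc; _+_; _*_; _<_; _<ᵇ_; _≡ᵇ_)
open import Data.Bool using (Bool; true; false; not; _∧_; _∨_; if_then_else_)
open import Data.List using (List; []; _∷_; _++_; [_]; map; reverse; upTo; concatMap; filterᵇ; length)
open import Data.Bool.ListAction using (any; all)
open import Data.Nat.ListAction using (sum)
open import Data.List.Membership.Propositional using (_∈_)
open import Data.List.Relation.Unary.All using (All)
open import Data.Maybe using (Maybe; just; nothing)
open import Data.Product using (Σ; Σ-syntax; ∃; ∃-syntax; _×_; _,_; proj₁)
open import Data.Sum using (_⊎_)
open import Data.Empty using (⊥)
open import Data.Unit using (⊤)
open import Relation.Binary.PropositionalEquality using (_≡_)

record Lit : Set where
  constructor lit
  field
    var : ℕ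
    pos : Bool
open Lit public

neg : Lit → Lit
neg (lit v b) = lit v (not b)

_==ᵇ_ : Bool → Bool → Bool
true  ==ᵇ b = b
false ==ᵇ b = not b

_==ᴸ_ : Lit → Lit → Bool
lit v b ==ᴸ lit w c = (v ≡ᵇ w) ∧ (b ==ᵇ c)

_∈ᴸ_ : Lit → List Lit → Bool
ℓ ∈ᴸ σ = any (ℓ ==ᴸ_) σ

_∈ⱽ_ : ℕ → List ℕ → Bool
v ∈ⱽ vs = any (v ≡ᵇ_) vs

Clause : Set
Clause = List Lit

data Quant : Set where
  ∃q ∀q : Quant

-- A quantifier prefix Q₁X₁ … QₛXₛ : the list of blocks, outermost first.
Prefix : Set
Prefix = List (Quant × List ℕ)

record QCNF : Set where
  constructor qcnf
  field
    prefix : Prefix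
    matrix : List Clause
open QCNF public

-- quantifier and level (1-based block index) of a variable.
private
  findBlock : ℕ → ℕ → Prefix → Maybe (Quant × ℕ)
  findBlock i v [] = nothing
  findBlock i v ((q , xs) ∷ P) = if v ∈ⱽ xs then just (q , i) else findBlock (suc i) v P

-- lv(v) = i iff v ∈ X_i (0 for variables not in the prefix; never used for them).
lvVar : Prefix → ℕ → ℕ
lvVar P v with findBlock 1 v P
... | just (_ , i) = i
... | nothing      = 0

isExVar : Prefix → ℕ → Bool
isExVar P v with findBlock 1 v P
... | just (∃q , _) = true
... | _             = false

isUnVar : Prefix → ℕ → Bool
isUnVar P v with findBlock 1 v P
... | just (∀q , _) = true
... | _             = false

inPrefix : Prefix → ℕ → Bool
inPrefix P v with findBlock 1 v P
... | just _  = true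
... | nothing = false

lv : Prefix → Lit → ℕ
lv P ℓ = lvVar P (var ℓ)

isEx isUn : Prefix → Lit → Bool
isEx P ℓ = isExVar P (var ℓ)
isUn P ℓ = isUnVar P (var ℓ)

red : Prefix → Clause → Clause
red P C = filterᵇ keep C
  where
  deleted : Lit → Bool
  deleted v = isUn P v ∧ all (λ x → not (isEx P x) ∨ (lv P x <ᵇ lv P v)) C
  keep : Lit → Bool
  keep v = not (deleted v)

-- (C₁ ∨ ℓ) ⊗_ℓ (C₂ ∨ ℓ̄) = C₁ ∨ C₂ ; here  resolve ℓ (C₁ ∨ ℓ) (C₂ ∨ ℓ̄).
resolve : Lit → Clause → Clause → Clause
resolve ℓ C D = filterᵇ (λ k → not (k ==ᴸ ℓ)) C ++ filterᵇ (λ k → not (k ==ᴸ neg ℓ)) D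

-- C|σ : nothing represents ⊤ (C ∩ σ ≠ ∅); otherwise the clause of the
-- ℓ ∈ C with ℓ̄ ∉ σ.
restrict : List Lit → Clause → Maybe Clause
restrict σ C =
  if any (_∈ᴸ σ) C then nothing
  else just (filterᵇ (λ ℓ → not (neg ℓ ∈ᴸ σ)) C)

-- A clause D is (as a set) the unit clause (x).
IsSingleton : Clause → Lit → Set
IsSingleton D x = (x ∈ D) × All (_≡ x) D

data Entry : Set where
  dec   : Lit → Entry
  prop  : Lit → Clause → Entry
  confl : Clause → Entry

Trail : Set
Trail = List Entry

assigned : Trail → List Lit
assigned [] = []
assigned (dec ℓ ∷ T)    = ℓ ∷ assigned T
assigned (prop ℓ _ ∷ T) = ℓ ∷ assigned T
assigned (confl _ ∷ T)  = assigned T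

decidedVars : Trail → List ℕ
decidedVars [] = []
decidedVars (dec ℓ ∷ T)    = var ℓ ∷ decidedVars T
decidedVars (prop _ _ ∷ T) = decidedVars T
decidedVars (confl _ ∷ T)  = decidedVars T

Fresh : Trail → Lit → Set
Fresh pre ℓ = All (λ k → var k ≢ℕ var ℓ) (assigned pre)
  where
  _≢ℕ_ : ℕ → ℕ → Set
  a ≢ℕ b = a ≡ b → ⊥

-- Conditions on an element e of a trail for Q·F, preceded by the initial
-- segment pre and followed by post (RED propagation, ASS-R-ORD decisions).
EntryOK : Prefix → List Clause → Trail → Entry → Trail → Set
EntryOK P F pre (dec ℓ) post =
  Fresh pre ℓ × inPrefix P (var ℓ) ≡ true ×
  (isEx P ℓ ≡ true →
     ∀ u → isUnVar P u ≡ true → lvVar P u < lv P ℓ → u ∈ decidedVars pre)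
EntryOK P F pre (prop ℓ A) post =
  Fresh pre ℓ × isEx P ℓ ≡ true × A ∈ F ×
  Σ[ D ∈ Clause ] (restrict (assigned pre) A ≡ just D × IsSingleton (red P D) ℓ)
EntryOK P F pre (confl A) post =
  post ≡ [] × A ∈ F ×
  Σ[ D ∈ Clause ] (restrict (assigned pre) A ≡ just D × red P D ≡ [])

record ConflictTrail (P : Prefix) (F : List Clause) (T : Trail) : Set where
  field
    entriesOK : ∀ pre e post → T ≡ pre ++ e ∷ post → EntryOK P F pre e post
    endsInConflict : Σ[ pre ∈ Trail ] Σ[ A ∈ Clause ] T ≡ pre ++ confl A ∷ []

EmptyReduct : Prefix → List Lit → Clause → Set
EmptyReduct P σ C = Σ[ D ∈ Clause ] (restrict σ C ≡ just D × red P D ≡ [])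

Unit : Prefix → List Lit → Clause → Set
Unit P σ C =
  Σ[ D ∈ Clause ] (restrict σ C ≡ just D ×
     (red P D ≡ [] ⊎ Σ[ x ∈ Lit ] (isEx P x ≡ true × IsSingleton (red P D) x)))

IsPropagated : Entry → Set
IsPropagated (dec _)    = ⊥
IsPropagated (prop _ _) = ⊤
IsPropagated (confl _)  = ⊤

IsConflict : Entry → Set
IsConflict (confl _) = ⊤
IsConflict _         = ⊥

-- Natural condition at the initial segment pre whose next element is e.
-- (That the propagated element is the literal of its unit antecedent is
-- part of EntryOK.)
NaturalAt : Prefix → List Clause → Trail → Entry → Set
NaturalAt P F pre e =
  (Σ[ C ∈ Clause ] (C ∈ F × Unit P (assigned pre) C) → IsPropagated e) ×
  (Σ[ C ∈ Clause ] (C ∈ F × EmptyReduct P (assigned pre) C) → IsConflict e)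

NaturalFrom : Prefix → List Clause → ℕ → Trail → Set
NaturalFrom P F k T =
  ∀ pre e post → T ≡ pre ++ e ∷ post → k Data.Nat.≤ length pre → NaturalAt P F pre e

data Mark : Set where
  dMark pMark : Lit → Mark
  ⊥Mark : Mark

strip : Entry → Mark
strip (dec ℓ)    = dMark ℓ
strip (prop ℓ _) = pMark ℓ
strip (confl _)  = ⊥Mark

-- walking leftwards over the (reversed) initial segment
learnSteps : Prefix → Trail → Clause → List Clause
learnSteps P [] C = C ∷ []
learnSteps P (dec _ ∷ es) C = learnSteps P es C
learnSteps P (confl _ ∷ es) C = learnSteps P es C
learnSteps P (prop p B ∷ es) C =
  if neg p ∈ᴸ C
  then C ∷ learnSteps P es (red P (resolve (neg p) C (red P B)))
  else C ∷ learnSteps P es C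

Learnable : Prefix → Trail → Clause → Set
Learnable P T C =
  Σ[ pre ∈ Trail ] Σ[ A ∈ Clause ]
    (T ≡ pre ++ confl A ∷ [] × C ∈ learnSteps P (reverse pre) (red P A))

-- restart condition relating T to the previous trail (nothing for T₁)
RestartOK : Prefix → List Clause → Maybe Trail → Trail → Set
RestartOK P F nothing T = NaturalFrom P F 0 T
RestartOK P F (just T′) T =
  Σ[ S ∈ Trail ] Σ[ S′ ∈ Trail ]
    ((Σ[ R ∈ Trail ] T ≡ S ++ R) × (Σ[ R′ ∈ Trail ] T′ ≡ S′ ++ R′) ×
     map strip S ≡ map strip S′ × NaturalFrom P F (length S) T)

Step : Prefix → List Clause → Maybe Trail → Trail → Clause → Set
Step P F prev T C = ConflictTrail P F T × Learnable P T C × RestartOK P F prev T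

RefSeq : Prefix → List Clause → Maybe Trail → List (Trail × Clause) → Set
RefSeq P F prev [] = ⊥
RefSeq P F prev ((T , C) ∷ []) = Step P F prev T C × C ≡ []
RefSeq P F prev ((T , C) ∷ (x ∷ xs)) =
  Step P F prev T C × RefSeq P (F ++ C ∷ []) (just T) (x ∷ xs)

IsRefutation : QCNF → List (Trail × Clause) → Set
IsRefutation Φ R = RefSeq (prefix Φ) (matrix Φ) nothing R

refSize : List (Trail × Clause) → ℕ
refSize R = sum (map (λ p → length (proj₁ p)) R)

Equality : ℕ → QCNF
Equality n = qcnf P (tClause ∷ concatMap pair (upTo n))
  where
  x u t : ℕ → ℕ
  x i = i
  u i = n + i
  t i = n + n + i
  P : Prefix
  P = (∃q , map x (upTo n)) ∷ (∀q , map u (upTo n)) ∷ (∃q , map t (upTo n)) ∷ []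
  tClause : Clause
  tClause = map (λ i → lit (t i) false) (upTo n)
  pair : ℕ → List Clause
  pair i = (lit (x i) false ∷ lit (u i) false ∷ lit (t i) true ∷ [])
         ∷ (lit (x i) true ∷ lit (u i) true ∷ lit (t i) true ∷ []) ∷ []

module Submission where

-- Write n = n' + 1. Block j decides x_j and u_j and propagates t_j from (x̄_j ∨ ū_j ∨ t_j).
-- The first trail plays the blocks j < n', propagates t̄_n' and x̄_n' and falsifies (x_n' ∨ u_n' ∨ t_n');
-- resolving back learns M = t̄_0 ∨ … ∨ t̄_(n'-1) ∨ u_n'. For m = n' - 1, …, 0 two trails remove t̄_m from M:
-- playing blocks 0 … m falsifies M and teaches A = t̄_0 ∨ … ∨ t̄_(m-1) ∨ x̄_m ∨ U, and playing the blocks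
-- below m, propagating x̄_m from A, deciding ū_m and propagating t_m falsifies M again and teaches
-- t̄_0 ∨ … ∨ t̄_(m-1) ∨ U′. Universal literals survive reduction only while some t̄ is left, so the last
-- clause learned is empty. No clause becomes unit before the intended propagations, so all trails are
-- natural and restart from scratch, and only x's and u's are decided, as ASS-R-ORD requires.
-- This gives 2n' + 1 trails of at most 3n elements each.

open import Defs
open import Data.Nat using (ℕ; zero; suc; _+_; _*_; _^_; _≤_; _<_; z≤n; s≤s; _≡ᵇ_; _<ᵇ_; _<?_)
open import Data.Nat.Properties
open import Data.Nat.Solver using (module +-*-Solver)
open import Data.Bool using (Bool; true; false; not; _∧_; _∨_; T; T?) renaming (_≟_ to _≟ᵇ_)
open import Data.Bool.Properties using (T-≡; not-¬; not-involutive)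
open import Data.Bool.ListAction using (any; all)
open import Data.List using (List; []; _∷_; _++_; _∷ʳ_; map; upTo; concatMap; reverse; filterᵇ; length)
open import Data.List.Properties using (∷-injective; ++-conicalʳ; ++-assoc; ++-identityʳ; reverse-++)
open import Data.List.Membership.Propositional using (_∈_)
open import Data.List.Membership.Propositional.Properties
  using (∈-filter⁺; ∈-filter⁻; ∈-++⁺ˡ; ∈-++⁺ʳ; ∈-++⁻; ∈-map⁺; ∈-map⁻; ∈-upTo⁺; ∈-upTo⁻; ∈-concat⁺′; ∈-concat⁻′)
open import Data.List.Relation.Unary.Any using (here; there)
open import Data.List.Relation.Unary.All as All using (All; []; _∷_)
open import Data.Maybe using (just; nothing)
open import Data.Maybe.Properties using (just-injective)
open import Data.Product using (Σ-syntax; _×_; _,_; proj₁; proj₂)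
open import Data.Sum using (_⊎_; inj₁; inj₂; [_,_]′)
open import Data.Empty using (⊥; ⊥-elim)
open import Data.Unit using (tt)
open import Function using (_∘_; Equivalence)
open import Relation.Binary.Definitions using (tri<; tri≈; tri>)
open import Relation.Nullary using (yes; no)
open import Relation.Binary.PropositionalEquality

T⇒≡ : ∀ {b} → T b → b ≡ true
T⇒≡ = Equivalence.to T-≡

≡⇒T : ∀ {b} → b ≡ true → T b
≡⇒T = Equivalence.from T-≡

==ᵇ⇒≡ : ∀ b c → (b ==ᵇ c) ≡ true → b ≡ c
==ᵇ⇒≡ true  true  _ = refl
==ᵇ⇒≡ false false _ = refl

==ᵇ-refl : ∀ b → (b ==ᵇ b) ≡ true
==ᵇ-refl true  = refl
==ᵇ-refl false = refl

==ᴸ⇒≡ : ∀ a b → (a ==ᴸ b) ≡ true → a ≡ b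
==ᴸ⇒≡ (lit v x) (lit w y) e with v ≡ᵇ w in eq
... | true rewrite ≡ᵇ⇒≡ v w (≡⇒T eq) | ==ᵇ⇒≡ x y e = refl

==ᴸ-refl : ∀ a → (a ==ᴸ a) ≡ true
==ᴸ-refl (lit v x) rewrite T⇒≡ (≡⇒≡ᵇ v v refl) | ==ᵇ-refl x = refl

not-==ᴸ⇒≢ : ∀ {a b} → not (a ==ᴸ b) ≡ true → a ≡ b → ⊥
not-==ᴸ⇒≢ {a} e refl with trans (sym (cong not (==ᴸ-refl a))) e
... | ()

≢⇒==ᴸ-false : ∀ {a b} → (a ≡ b → ⊥) → (a ==ᴸ b) ≡ false
≢⇒==ᴸ-false {a} {b} a≢b with a ==ᴸ b in eq
... | true  = ⊥-elim (a≢b (==ᴸ⇒≡ a b eq))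
... | false = refl

module _ {A : Set} (p : A → Bool) where

  any-true : ∀ {xs x} → x ∈ xs → p x ≡ true → any p xs ≡ true
  any-true {x ∷ xs} (here refl) e rewrite e = refl
  any-true {x ∷ xs} (there m)   e with p x
  ... | true  = refl
  ... | false = any-true m e

  any-false : ∀ xs → (∀ x → x ∈ xs → p x ≡ false) → any p xs ≡ false
  any-false []       h = refl
  any-false (x ∷ xs) h rewrite h x (here refl) = any-false xs (λ y m → h y (there m))

  all-true : ∀ xs → (∀ x → x ∈ xs → p x ≡ true) → all p xs ≡ true
  all-true []       h = refl
  all-true (x ∷ xs) h rewrite h x (here refl) = all-true xs (λ y m → h y (there m))

  all-false : ∀ {xs x} → x ∈ xs → p x ≡ false → all p xs ≡ false
  all-false {x ∷ xs} (here refl) e rewrite e = refl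
  all-false {x ∷ xs} (there m)   e with p x
  ... | true  = all-false m e
  ... | false = refl

  ∈-filterᵇ⁺ : ∀ {xs x} → x ∈ xs → p x ≡ true → x ∈ filterᵇ p xs
  ∈-filterᵇ⁺ m e = ∈-filter⁺ (T? ∘ p) m (≡⇒T e)

  ∈-filterᵇ⁻ : ∀ {xs x} → x ∈ filterᵇ p xs → x ∈ xs × p x ≡ true
  ∈-filterᵇ⁻ m with ∈-filter⁻ (T? ∘ p) m
  ... | x∈xs , px = x∈xs , T⇒≡ px

∈ᴸ-true : ∀ {a} σ → a ∈ σ → (a ∈ᴸ σ) ≡ true
∈ᴸ-true {a} σ m = any-true (a ==ᴸ_) m (==ᴸ-refl a)

∈ᴸ-false : ∀ {a} σ → (∀ k → k ∈ σ → a ≡ k → ⊥) → (a ∈ᴸ σ) ≡ false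
∈ᴸ-false {a} σ h = any-false (a ==ᴸ_) σ (λ k m → ≢⇒==ᴸ-false (h k m))

∈ⱽ-true : ∀ {v vs} → v ∈ vs → (v ∈ⱽ vs) ≡ true
∈ⱽ-true {v} m = any-true (v ≡ᵇ_) m (T⇒≡ (≡⇒≡ᵇ v v refl))

∈ⱽ-false : ∀ {v} vs → (∀ w → w ∈ vs → v ≡ w → ⊥) → (v ∈ⱽ vs) ≡ false
∈ⱽ-false {v} vs h = any-false (v ≡ᵇ_) vs f
  where
  f : ∀ w → w ∈ vs → (v ≡ᵇ w) ≡ false
  f w m with v ≡ᵇ w in eq
  ... | true  = ⊥-elim (h w m (≡ᵇ⇒≡ v w (≡⇒T eq)))
  ... | false = refl

∀∉⇒≡[] : ∀ {A : Set} (xs : List A) → (∀ x → x ∈ xs → ⊥) → xs ≡ []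
∀∉⇒≡[] []       h = refl
∀∉⇒≡[] (x ∷ xs) h = ⊥-elim (h x (here refl))

<⇒<ᵇ-flip-false : ∀ {a b} → a < b → (b <ᵇ a) ≡ false
<⇒<ᵇ-flip-false {a} {b} a<b with b <ᵇ a in eq
... | true  = ⊥-elim (<-asym a<b (<ᵇ⇒< b a (≡⇒T eq)))
... | false = refl

∈-∷ʳ⁻ : ∀ {A : Set} xs {x y : A} → y ∈ xs ∷ʳ x → y ∈ xs ⊎ y ≡ x
∈-∷ʳ⁻ xs m with ∈-++⁻ xs m
... | inj₁ y∈xs       = inj₁ y∈xs
... | inj₂ (here y≡x) = inj₂ y≡x

++-split : ∀ {A : Set} (xs ys : List A) pre e post → xs ++ ys ≡ pre ++ e ∷ post →
  Σ[ post′ ∈ List A ] xs ≡ pre ++ e ∷ post′ ⊎ Σ[ pre′ ∈ List A ] (pre ≡ xs ++ pre′ × ys ≡ pre′ ++ e ∷ post)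
++-split []       ys pre         e post eq   = inj₂ (pre , refl , eq)
++-split (x ∷ xs) ys []          e post refl = inj₁ (xs , refl)
++-split (x ∷ xs) ys (_ ∷ pre)   e post eq with ∷-injective eq
... | refl , eq′ with ++-split xs ys pre e post eq′
...   | inj₁ (post′ , refl)      = inj₁ (post′ , refl)
...   | inj₂ (pre′ , refl , eq″) = inj₂ (pre′ , refl , eq″)

∷ʳ-split : ∀ {A : Set} (xs : List A) z pre e post → xs ∷ʳ z ≡ pre ++ e ∷ post →
  Σ[ post′ ∈ List A ] xs ≡ pre ++ e ∷ post′ ⊎ (pre ≡ xs × e ≡ z × post ≡ [])
∷ʳ-split []       z []            e post refl = inj₂ (refl , refl , refl)
∷ʳ-split []       z (_ ∷ [])      e post ()
∷ʳ-split []       z (_ ∷ _ ∷ _)   e post ()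
∷ʳ-split (x ∷ xs) z []            e post refl = inj₁ (xs , refl)
∷ʳ-split (x ∷ xs) z (_ ∷ pre)     e post eq with ∷-injective eq
... | refl , eq′ with ∷ʳ-split xs z pre e post eq′
... | inj₁ (post′ , refl)       = inj₁ (post′ , refl)
... | inj₂ (refl , refl , refl) = inj₂ (refl , refl , refl)

Live : List Lit → Lit → Set
Live σ a = (neg a ∈ᴸ σ) ≡ false

restrict-just : ∀ σ C {D} → restrict σ C ≡ just D →
  any (_∈ᴸ σ) C ≡ false × filterᵇ (λ ℓ → not (neg ℓ ∈ᴸ σ)) C ≡ D
restrict-just σ C eq with any (_∈ᴸ σ) C
... | false = refl , just-injective eq

restrict-unsatisfied : ∀ σ C → (∀ y → y ∈ C → (y ∈ᴸ σ) ≡ false) →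
  restrict σ C ≡ just (filterᵇ (λ ℓ → not (neg ℓ ∈ᴸ σ)) C)
restrict-unsatisfied σ C h rewrite any-false (_∈ᴸ σ) C h = refl

∈-restrict⁺ : ∀ σ {C D a} → restrict σ C ≡ just D → a ∈ C → Live σ a → a ∈ D
∈-restrict⁺ σ {C} eq m live with restrict-just σ C eq
... | _ , refl = ∈-filterᵇ⁺ (λ ℓ → not (neg ℓ ∈ᴸ σ)) m (cong not live)

∈-restrict⁻ : ∀ σ {C D a} → restrict σ C ≡ just D → a ∈ D → a ∈ C × Live σ a
∈-restrict⁻ σ {C} eq m with restrict-just σ C eq
... | _ , refl with ∈-filterᵇ⁻ (λ ℓ → not (neg ℓ ∈ᴸ σ)) m
... | a∈C , e = a∈C , not-true e
  where
  not-true : ∀ {b} → not b ≡ true → b ≡ false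
  not-true {false} _ = refl

restrict-satisfied : ∀ σ {C D a} → restrict σ C ≡ just D → a ∈ C → (a ∈ᴸ σ) ≡ true → ⊥
restrict-satisfied σ {C} eq m sat with trans (sym (proj₁ (restrict-just σ C eq))) (any-true (_∈ᴸ σ) m sat)
... | ()

∈-resolveˡ : ∀ {ℓ C D a} → a ∈ C → (a ≡ ℓ → ⊥) → a ∈ resolve ℓ C D
∈-resolveˡ {ℓ} m a≢ℓ = ∈-++⁺ˡ (∈-filterᵇ⁺ (λ k → not (k ==ᴸ ℓ)) m (cong not (≢⇒==ᴸ-false a≢ℓ)))

∈-resolveʳ : ∀ {ℓ C D a} → a ∈ D → (a ≡ neg ℓ → ⊥) → a ∈ resolve ℓ C D
∈-resolveʳ {ℓ} m a≢ℓ̄ = ∈-++⁺ʳ _ (∈-filterᵇ⁺ (λ k → not (k ==ᴸ neg ℓ)) m (cong not (≢⇒==ᴸ-false a≢ℓ̄)))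

∈-resolve⁻ : ∀ {ℓ C D a} → a ∈ resolve ℓ C D →
  (a ∈ C × (a ≡ ℓ → ⊥)) ⊎ (a ∈ D × (a ≡ neg ℓ → ⊥))
∈-resolve⁻ {ℓ} {C} m with ∈-++⁻ (filterᵇ (λ k → not (k ==ᴸ ℓ)) C) m
... | inj₁ m₁ = let a∈C , e = ∈-filterᵇ⁻ (λ k → not (k ==ᴸ ℓ)) m₁ in inj₁ (a∈C , not-==ᴸ⇒≢ e)
... | inj₂ m₂ = let a∈D , e = ∈-filterᵇ⁻ (λ k → not (k ==ᴸ neg ℓ)) m₂ in inj₂ (a∈D , not-==ᴸ⇒≢ e)

module _ (P : Prefix) where

  private
    Removable : Clause → Lit → Bool
    Removable D v = all (λ x → not (isEx P x) ∨ (lv P x <ᵇ lv P v)) D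
    keep : Clause → Lit → Bool
    keep D v = not (isUn P v ∧ Removable D v)

  ∈-red-nonuniversal : ∀ {D a} → a ∈ D → isUn P a ≡ false → a ∈ red P D
  ∈-red-nonuniversal {D} {a} m un = ∈-filterᵇ⁺ (keep D) m kept
    where
    kept : not (isUn P a ∧ Removable D a) ≡ true
    kept rewrite un = refl

  ∈-red-dominated : ∀ {D a b} → a ∈ D → b ∈ D → isEx P b ≡ true → lv P a < lv P b → a ∈ red P D
  ∈-red-dominated {D} {a} {b} m mb ex lt = ∈-filterᵇ⁺ (keep D) m kept
    where
    b-blocks : (not (isEx P b) ∨ (lv P b <ᵇ lv P a)) ≡ false
    b-blocks rewrite ex = <⇒<ᵇ-flip-false lt
    kept : not (isUn P a ∧ Removable D a) ≡ true
    kept rewrite all-false (λ x → not (isEx P x) ∨ (lv P x <ᵇ lv P a)) mb b-blocks with isUn P a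
    ... | true  = refl
    ... | false = refl

  red-⊆ : ∀ {D a} → a ∈ red P D → a ∈ D
  red-⊆ {D} m = proj₁ (∈-filterᵇ⁻ (keep D) {D} m)

  ∉-red-undominated : ∀ {D a} → a ∈ red P D → isUn P a ≡ true →
    (∀ x → x ∈ D → isEx P x ≡ false ⊎ lv P x < lv P a) → ⊥
  ∉-red-undominated {D} {a} m un h with trans (sym (cong₂ (λ x y → not (x ∧ y)) un blocked)) (proj₂ (∈-filterᵇ⁻ (keep D) {D} m))
    where
    blocked : Removable D a ≡ true
    blocked = all-true _ D f
      where
      f : ∀ x → x ∈ D → not (isEx P x) ∨ (lv P x <ᵇ lv P a) ≡ true
      f x mx with h x mx
      ... | inj₁ e rewrite e = refl
      ... | inj₂ lt rewrite T⇒≡ (<⇒<ᵇ lt) with not (isEx P x)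
      ...   | true  = refl
      ...   | false = refl
  ... | ()

  survives : ∀ σ {C D a} → restrict σ C ≡ just D → a ∈ C → Live σ a → isUn P a ≡ false → a ∈ red P D
  survives σ eq m live un = ∈-red-nonuniversal (∈-restrict⁺ σ eq m live) un

  ¬Unit-two-survivors : ∀ σ {C a b} → a ∈ C → b ∈ C → Live σ a → Live σ b → (a ≡ b → ⊥) →
    isUn P a ≡ false → (isUn P b ≡ false ⊎ (isEx P a ≡ true × lv P b < lv P a)) → Unit P σ C → ⊥
  ¬Unit-two-survivors σ ma mb la lb a≢b ua ub (D , eq , r) = at-most-one r (survives σ eq ma la ua) (b∈ ub)
    where
    b∈ : _ ⊎ _ → _ ∈ red P D
    b∈ (inj₁ ub′)       = survives σ eq mb lb ub′
    b∈ (inj₂ (ea , lt)) = ∈-red-dominated (∈-restrict⁺ σ eq mb lb) (∈-restrict⁺ σ eq ma la) ea lt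
    at-most-one : ∀ {R} → (R ≡ [] ⊎ Σ[ x ∈ Lit ] (isEx P x ≡ true × IsSingleton R x)) → _ ∈ R → _ ∈ R → ⊥
    at-most-one (inj₁ refl) ()
    at-most-one (inj₂ (_ , _ , _ , all≡)) m₁ m₂ = a≢b (trans (All.lookup all≡ m₁) (sym (All.lookup all≡ m₂)))

  ¬EmptyReduct-survivor : ∀ σ {C a} → a ∈ C → Live σ a → isUn P a ≡ false → EmptyReduct P σ C → ⊥
  ¬EmptyReduct-survivor σ ma la ua (D , eq , r) with subst (_ ∈_) r (survives σ eq ma la ua)
  ... | ()

  ¬Unit-satisfied : ∀ σ {C a} → a ∈ C → (a ∈ᴸ σ) ≡ true → Unit P σ C → ⊥
  ¬Unit-satisfied σ ma sat (_ , eq , _) = restrict-satisfied σ eq ma sat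

  ¬EmptyReduct-satisfied : ∀ σ {C a} → a ∈ C → (a ∈ᴸ σ) ≡ true → EmptyReduct P σ C → ⊥
  ¬EmptyReduct-satisfied σ ma sat (_ , eq , _) = restrict-satisfied σ eq ma sat

  UnitFor : List Lit → Clause → Lit → Set
  UnitFor σ C ℓ = ∀ y → y ∈ C →
    y ≡ ℓ ⊎ (neg y ∈ᴸ σ) ≡ true ⊎ (isUn P y ≡ true × isEx P y ≡ false × lv P ℓ < lv P y)

  red-restrict-singleton : ∀ σ {C D ℓ} → restrict σ C ≡ just D → ℓ ∈ C → Live σ ℓ → isUn P ℓ ≡ false →
    UnitFor σ C ℓ → IsSingleton (red P D) ℓ
  red-restrict-singleton σ {C} {D} {ℓ} eq mℓ lℓ uℓ h = survives σ eq mℓ lℓ uℓ , All.tabulate only-ℓ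
    where
    only-ℓ : ∀ {y} → y ∈ red P D → y ≡ ℓ
    only-ℓ {y} my with ∈-restrict⁻ σ eq (red-⊆ my)
    ... | myC , ly with h y myC
    ...   | inj₁ e = e
    ...   | inj₂ (inj₁ fl) with () ← trans (sym fl) ly
    ...   | inj₂ (inj₂ (uy , _ , lt)) = ⊥-elim (∉-red-undominated my uy right-of-ℓ)
      where
      right-of-ℓ : ∀ x → x ∈ D → isEx P x ≡ false ⊎ lv P x < lv P y
      right-of-ℓ x mx with ∈-restrict⁻ σ eq mx
      ... | mxC , lx with h x mxC
      ...   | inj₁ refl                 = inj₂ lt
      ...   | inj₂ (inj₁ fl)            with () ← trans (sym fl) lx
      ...   | inj₂ (inj₂ (_ , ex , _)) = inj₁ ex

  red-restrict-empty : ∀ σ {C D} → restrict σ C ≡ just D →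
    (∀ y → y ∈ C → (neg y ∈ᴸ σ) ≡ true ⊎ (isUn P y ≡ true × isEx P y ≡ false)) → red P D ≡ []
  red-restrict-empty σ {C} {D} eq h = ∀∉⇒≡[] (red P D) ∉red
    where
    universal : ∀ y → y ∈ D → isUn P y ≡ true × isEx P y ≡ false
    universal y my with ∈-restrict⁻ σ eq my
    ... | myC , ly with h y myC
    ...   | inj₁ fl  with () ← trans (sym fl) ly
    ...   | inj₂ uy = uy
    ∉red : ∀ y → y ∈ red P D → ⊥
    ∉red y my = ∉-red-undominated my (proj₁ (universal y (red-⊆ my))) (λ x mx → inj₁ (proj₂ (universal x mx)))

assigned-++ : ∀ xs ys → assigned (xs ++ ys) ≡ assigned xs ++ assigned ys
assigned-++ []               ys = refl
assigned-++ (dec ℓ ∷ xs)     ys = cong (ℓ ∷_) (assigned-++ xs ys)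
assigned-++ (prop ℓ _ ∷ xs)  ys = cong (ℓ ∷_) (assigned-++ xs ys)
assigned-++ (confl _ ∷ xs)   ys = assigned-++ xs ys

module _ (P : Prefix) where

  learnSteps-head : ∀ es C → C ∈ learnSteps P es C
  learnSteps-head []              C = here refl
  learnSteps-head (dec _ ∷ es)    C = learnSteps-head es C
  learnSteps-head (confl _ ∷ es)  C = learnSteps-head es C
  learnSteps-head (prop p B ∷ es) C with neg p ∈ᴸ C
  ... | true  = here refl
  ... | false = here refl

  learnSteps-resolve : ∀ p B es C {D} → (neg p ∈ᴸ C) ≡ true →
    D ∈ learnSteps P es (red P (resolve (neg p) C (red P B))) → D ∈ learnSteps P (prop p B ∷ es) C
  learnSteps-resolve p B es C clash m rewrite clash = there m

  VarFree : List Lit → Lit → Set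
  VarFree σ ℓ = ∀ k → k ∈ σ → var k ≡ var ℓ → ⊥

  NoUnit NoEmpty : List Clause → List Lit → Set
  NoUnit  F σ = ∀ C → C ∈ F → Unit P σ C → ⊥
  NoEmpty F σ = ∀ C → C ∈ F → EmptyReduct P σ C → ⊥

  record Legal (F : List Clause) (pre : Trail) (e : Entry) : Set where
    constructor legal
    field
      entry-ok : ∀ post → EntryOK P F pre e post
      natural  : NaturalAt P F pre e

  legal-decision : ∀ {F} pre {σ ℓ} → assigned pre ≡ σ → VarFree σ ℓ → inPrefix P (var ℓ) ≡ true →
    (isEx P ℓ ≡ true → ∀ u → isUnVar P u ≡ true → lvVar P u < lv P ℓ → ⊥) → NoUnit F σ →
    Legal F pre (dec ℓ)
  legal-decision pre refl free inP no-universal-left no-unit = legal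
    (λ post → All.tabulate (λ {k} m → free k m) , inP , λ ex u un lt → ⊥-elim (no-universal-left ex u un lt))
    ((λ (C , m , u) → no-unit C m u) , (λ (C , m , (D , e , r)) → no-unit C m (D , e , inj₁ r)))

  legal-propagation : ∀ {F} pre {σ ℓ A} → assigned pre ≡ σ → VarFree σ ℓ → isEx P ℓ ≡ true → isUn P ℓ ≡ false →
    A ∈ F → (∀ y → y ∈ A → (y ∈ᴸ σ) ≡ false) → ℓ ∈ A → Live σ ℓ → UnitFor P σ A ℓ → NoEmpty F σ →
    Legal F pre (prop ℓ A)
  legal-propagation {F} pre {σ} {A = A} refl free ex un A∈F unsat ℓ∈A live unit no-empty = legal
    (λ post → All.tabulate (λ {k} m → free k m) , ex , A∈F , _ , restrict-unsatisfied σ A unsat ,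
              red-restrict-singleton P σ (restrict-unsatisfied σ A unsat) ℓ∈A live un unit)
    ((λ _ → tt) , (λ (C , m , e) → no-empty C m e))

  conflict-ok : ∀ {F} pre {σ A} → assigned pre ≡ σ → A ∈ F → (∀ y → y ∈ A → (y ∈ᴸ σ) ≡ false) →
    (∀ y → y ∈ A → (neg y ∈ᴸ σ) ≡ true ⊎ (isUn P y ≡ true × isEx P y ≡ false)) →
    EntryOK P F pre (confl A) []
  conflict-ok pre {σ} {A} refl A∈F unsat falsified =
    refl , A∈F , _ , restrict-unsatisfied σ A unsat , red-restrict-empty P σ (restrict-unsatisfied σ A unsat) falsified

  LegalPrefix : List Clause → Trail → Set
  LegalPrefix F S = ∀ pre e post → S ≡ pre ++ e ∷ post → Legal F pre e

  LegalAfter : List Clause → Trail → Trail → Set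
  LegalAfter F S R = ∀ pre e post → R ≡ pre ++ e ∷ post → Legal F (S ++ pre) e

  legal-[] : ∀ {F} → LegalPrefix F []
  legal-[] []      _ _ ()
  legal-[] (_ ∷ _) _ _ ()

  legal-++ : ∀ {F} S R → LegalPrefix F S → LegalAfter F S R → LegalPrefix F (S ++ R)
  legal-++ S R legalS legalR pre e post eq with ++-split S R pre e post eq
  ... | inj₁ (post′ , eq′)        = legalS pre e post′ eq′
  ... | inj₂ (pre′ , refl , eq′) = legalR pre′ e post eq′

  legalAfter₂ : ∀ {F S a b} → Legal F (S ++ []) a → Legal F (S ++ a ∷ []) b → LegalAfter F S (a ∷ b ∷ [])
  legalAfter₂ La Lb []                _ _ refl = La
  legalAfter₂ La Lb (_ ∷ [])          _ _ refl = Lb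
  legalAfter₂ La Lb (_ ∷ _ ∷ pre) e post eq with () ← ++-conicalʳ pre _ (sym (proj₂ (∷-injective (proj₂ (∷-injective eq)))))

  legalAfter₃ : ∀ {F S a b c} → Legal F (S ++ []) a → Legal F (S ++ a ∷ []) b → Legal F (S ++ a ∷ b ∷ []) c →
    LegalAfter F S (a ∷ b ∷ c ∷ [])
  legalAfter₃ La Lb Lc []                _ _ refl = La
  legalAfter₃ La Lb Lc (_ ∷ [])          _ _ refl = Lb
  legalAfter₃ La Lb Lc (_ ∷ _ ∷ [])      _ _ refl = Lc
  legalAfter₃ La Lb Lc (_ ∷ _ ∷ _ ∷ pre) e post eq
    with () ← ++-conicalʳ pre _ (sym (proj₂ (∷-injective (proj₂ (∷-injective (proj₂ (∷-injective eq)))))))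

  -- Every trail is natural throughout, so each one can restart from the empty segment.
  conflict-step : ∀ {F} S {A C} prev → LegalPrefix F S → EntryOK P F S (confl A) [] →
    C ∈ learnSteps P (reverse S) (red P A) → Step P F prev (S ∷ʳ confl A) C
  conflict-step {F} S {A} prev legalS conflict learned = trail , (S , A , refl , learned) , restart prev
    where
    trail : ConflictTrail P F (S ∷ʳ confl A)
    trail = record { entriesOK = entries ; endsInConflict = S , A , refl }
      where
      entries : ∀ pre e post → S ∷ʳ confl A ≡ pre ++ e ∷ post → EntryOK P F pre e post
      entries pre e post eq with ∷ʳ-split S (confl A) pre e post eq
      ... | inj₁ (post′ , eq′)       = Legal.entry-ok (legalS pre e post′ eq′) post
      ... | inj₂ (refl , refl , refl) = conflict
    natural : NaturalFrom P F 0 (S ∷ʳ confl A)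
    natural pre e post eq _ with ∷ʳ-split S (confl A) pre e post eq
    ... | inj₁ (post′ , eq′)       = Legal.natural (legalS pre e post′ eq′)
    ... | inj₂ (refl , refl , refl) = (λ _ → tt) , (λ _ → tt)
    restart : ∀ prev → RestartOK P F prev (S ∷ʳ confl A)
    restart nothing  = natural
    restart (just _) = [] , [] , (_ , refl) , (_ , refl) , refl , natural

data Kind : Set where
  KX KU KT : Kind

exK unK : Kind → Bool
exK KX = true
exK KU = false
exK KT = true
unK KX = false
unK KU = true
unK KT = false

lvK : Kind → ℕ
lvK KX = 1
lvK KU = 2
lvK KT = 3

record Quantified (P : Prefix) (v : ℕ) (κ : Kind) : Set where
  field
    isEx-var    : isExVar P v ≡ exK κ
    isUn-var    : isUnVar P v ≡ unK κ
    lv-var      : lvVar P v ≡ lvK κ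
    in-prefix   : inPrefix P v ≡ true

module _ (xs us ts : List ℕ) where

  ∃∀∃ : Prefix
  ∃∀∃ = (∃q , xs) ∷ (∀q , us) ∷ (∃q , ts) ∷ []

  private
    quantified : ∀ {v κ} →
      isExVar ∃∀∃ v ≡ exK κ × isUnVar ∃∀∃ v ≡ unK κ × lvVar ∃∀∃ v ≡ lvK κ × inPrefix ∃∀∃ v ≡ true →
      Quantified ∃∀∃ v κ
    quantified (e , u , l , i) = record { isEx-var = e ; isUn-var = u ; lv-var = l ; in-prefix = i }

  in-∃₁ : ∀ v → v ∈ⱽ xs ≡ true → Quantified ∃∀∃ v KX
  in-∃₁ v e = quantified facts
    where
    facts : isExVar ∃∀∃ v ≡ true × isUnVar ∃∀∃ v ≡ false × lvVar ∃∀∃ v ≡ 1 × inPrefix ∃∀∃ v ≡ true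
    facts rewrite e = refl , refl , refl , refl

  in-∀ : ∀ v → v ∈ⱽ xs ≡ false → v ∈ⱽ us ≡ true → Quantified ∃∀∃ v KU
  in-∀ v e₁ e₂ = quantified facts
    where
    facts : isExVar ∃∀∃ v ≡ false × isUnVar ∃∀∃ v ≡ true × lvVar ∃∀∃ v ≡ 2 × inPrefix ∃∀∃ v ≡ true
    facts rewrite e₁ | e₂ = refl , refl , refl , refl

  in-∃₂ : ∀ v → v ∈ⱽ xs ≡ false → v ∈ⱽ us ≡ false → v ∈ⱽ ts ≡ true → Quantified ∃∀∃ v KT
  in-∃₂ v e₁ e₂ e₃ = quantified facts
    where
    facts : isExVar ∃∀∃ v ≡ true × isUnVar ∃∀∃ v ≡ false × lvVar ∃∀∃ v ≡ 3 × inPrefix ∃∀∃ v ≡ true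
    facts rewrite e₁ | e₂ | e₃ = refl , refl , refl , refl

  universal-level : ∀ v → isUnVar ∃∀∃ v ≡ true → lvVar ∃∀∃ v ≡ 2
  universal-level v un with v ∈ⱽ xs | v ∈ⱽ us | v ∈ⱽ ts
  ... | true  | _     | _    with () ← un
  ... | false | true  | _    = refl
  ... | false | false | true  with () ← un
  ... | false | false | false with () ← un

-- Literals and clauses of Equality (suc n'), defined so as to agree definitionally with Defs.Equality.
module Literals (n' : ℕ) where

  n : ℕ
  n = suc n'

  code : Kind → ℕ → ℕ
  code KX i = i
  code KU i = n + i
  code KT i = n + n + i

  L : Kind → ℕ → Bool → Lit
  L κ i b = lit (code κ i) b

  block-of : Kind → List ℕ
  block-of κ = map (code κ) (upTo n)

  P : Prefix
  P = ∃∀∃ (block-of KX) (block-of KU) (block-of KT)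

  tClause : Clause
  tClause = map (λ i → L KT i false) (upTo n)

  pairClause : Bool → ℕ → Clause
  pairClause b i = L KX i b ∷ L KU i b ∷ L KT i true ∷ []

  negClause posClause : ℕ → Clause
  negClause = pairClause false
  posClause = pairClause true

  clausePair : ℕ → List Clause
  clausePair i = negClause i ∷ posClause i ∷ []

  Mat : List Clause
  Mat = tClause ∷ concatMap clausePair (upTo n)

  private
    below-n : ∀ {i k} → i < n → n ≤ k → i ≡ k → ⊥
    below-n i<n n≤k refl = <-irrefl refl (<-≤-trans i<n n≤k)

  code-inj : ∀ {κ κ′ i j} → i < n → j < n → code κ i ≡ code κ′ j → κ ≡ κ′ × i ≡ j
  code-inj {KX} {KX} _  _  e = refl , e
  code-inj {KU} {KU} _  _  e = refl , +-cancelˡ-≡ n _ _ e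
  code-inj {KT} {KT} _  _  e = refl , +-cancelˡ-≡ (n + n) _ _ e
  code-inj {KX} {KU} {j = j} hi _ e = ⊥-elim (below-n hi (m≤m+n n j) e)
  code-inj {KX} {KT} {j = j} hi _ e = ⊥-elim (below-n hi (≤-trans (m≤m+n n n) (m≤m+n (n + n) j)) e)
  code-inj {KU} {KX} {i = i} _ hj e = ⊥-elim (below-n hj (m≤m+n n i) (sym e))
  code-inj {KT} {KX} {i = i} _ hj e = ⊥-elim (below-n hj (≤-trans (m≤m+n n n) (m≤m+n (n + n) i)) (sym e))
  code-inj {KU} {KT} {j = j} hi _ e =
    ⊥-elim (below-n hi (m≤m+n n j) (+-cancelˡ-≡ n _ _ (trans e (+-assoc n n j))))
  code-inj {KT} {KU} {i = i} _ hj e =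
    ⊥-elim (below-n hj (m≤m+n n i) (sym (+-cancelˡ-≡ n _ _ (trans (sym (+-assoc n n i)) e))))

  ∈-block : ∀ κ {i} → i < n → (code κ i ∈ⱽ block-of κ) ≡ true
  ∈-block κ i<n = ∈ⱽ-true (∈-map⁺ (code κ) (∈-upTo⁺ i<n))

  ∉-block : ∀ κ κ′ {i} → i < n → (κ ≡ κ′ → ⊥) → (code κ i ∈ⱽ block-of κ′) ≡ false
  ∉-block κ κ′ {i} i<n κ≢κ′ = ∈ⱽ-false _ different
    where
    different : ∀ w → w ∈ block-of κ′ → code κ i ≡ w → ⊥
    different w m e with ∈-map⁻ (code κ′) m
    ... | j , j∈ , refl = κ≢κ′ (proj₁ (code-inj i<n (∈-upTo⁻ j∈) e))

  quantified : ∀ κ {i} → i < n → Quantified P (code κ i) κ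
  quantified KX i<n = in-∃₁ _ _ _ _ (∈-block KX i<n)
  quantified KU i<n = in-∀ _ _ _ _ (∉-block KU KX i<n (λ ())) (∈-block KU i<n)
  quantified KT i<n = in-∃₂ _ _ _ _ (∉-block KT KX i<n (λ ())) (∉-block KT KU i<n (λ ())) (∈-block KT i<n)

  universal-lv : ∀ v → isUnVar P v ≡ true → lvVar P v ≡ 2
  universal-lv = universal-level (block-of KX) (block-of KU) (block-of KT)

  isEx-L : ∀ κ {i} b → i < n → isEx P (L κ i b) ≡ exK κ
  isEx-L κ b i<n = Quantified.isEx-var (quantified κ i<n)

  isUn-L : ∀ κ {i} b → i < n → isUn P (L κ i b) ≡ unK κ
  isUn-L κ b i<n = Quantified.isUn-var (quantified κ i<n)

  lv-L : ∀ κ {i} b → i < n → lv P (L κ i b) ≡ lvK κ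
  lv-L κ b i<n = Quantified.lv-var (quantified κ i<n)

  L-inj : ∀ {κ κ′ i j b c} → i < n → j < n → L κ i b ≡ L κ′ j c → κ ≡ κ′ × i ≡ j × b ≡ c
  L-inj i<n j<n e with code-inj i<n j<n (cong var e)
  ... | κ≡κ′ , i≡j = κ≡κ′ , i≡j , cong pos e

  ≢-kind : ∀ κ i κ′ j {b c} → i < n → j < n → (κ ≡ κ′ → ⊥) → L κ i b ≡ L κ′ j c → ⊥
  ≢-kind κ i κ′ j i<n j<n κ≢κ′ e = κ≢κ′ (proj₁ (L-inj {κ} {κ′} i<n j<n e))

  ≢-index : ∀ κ i κ′ j {b c} → i < n → j < n → (i ≡ j → ⊥) → L κ i b ≡ L κ′ j c → ⊥
  ≢-index κ i κ′ j i<n j<n i≢j e = i≢j (proj₁ (proj₂ (L-inj {κ} {κ′} i<n j<n e)))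

  ≢-polarity : ∀ {a c : Lit} → (pos a ≡ pos c → ⊥) → a ≡ c → ⊥
  ≢-polarity b≢c e = b≢c (cong pos e)

  ≢-var : ∀ κ i κ′ j → i < n → j < n → (κ ≡ κ′ → ⊥) → code κ i ≡ code κ′ j → ⊥
  ≢-var κ i κ′ j i<n j<n κ≢κ′ e = κ≢κ′ (proj₁ (code-inj {κ} {κ′} i<n j<n e))

  ∈-tClause : ∀ {i} → i < n → L KT i false ∈ tClause
  ∈-tClause i<n = ∈-map⁺ (λ i → L KT i false) (∈-upTo⁺ i<n)

  ∈-tClause⁻ : ∀ {y} → y ∈ tClause → Σ[ i ∈ ℕ ] (i < n × y ≡ L KT i false)
  ∈-tClause⁻ m with ∈-map⁻ (λ i → L KT i false) m
  ... | i , i∈ , e = i , ∈-upTo⁻ i∈ , e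

  ∈-Mat⁻ : ∀ {C} → C ∈ Mat → C ≡ tClause ⊎ Σ[ b ∈ Bool ] Σ[ i ∈ ℕ ] (i < n × C ≡ pairClause b i)
  ∈-Mat⁻ (here e) = inj₁ e
  ∈-Mat⁻ (there m) with ∈-concat⁻′ (map clausePair (upTo n)) m
  ... | _ , C∈ , pair∈ with ∈-map⁻ clausePair pair∈
  ...   | i , i∈ , refl with C∈
  ...     | here e         = inj₂ (false , i , ∈-upTo⁻ i∈ , e)
  ...     | there (here e) = inj₂ (true , i , ∈-upTo⁻ i∈ , e)

  pairClause∈Mat : ∀ b {i} → i < n → pairClause b i ∈ Mat
  pairClause∈Mat false i<n = there (∈-concat⁺′ (here refl) (∈-map⁺ clausePair (∈-upTo⁺ i<n)))
  pairClause∈Mat true  i<n = there (∈-concat⁺′ (there (here refl)) (∈-map⁺ clausePair (∈-upTo⁺ i<n)))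

module Blocks (n' : ℕ) where
  open Literals n'

  block : ℕ → Trail
  block j = dec (L KX j true) ∷ dec (L KU j true) ∷ prop (L KT j true) (negClause j) ∷ []

  blocks : ℕ → Trail
  blocks zero    = []
  blocks (suc j) = blocks j ++ block j

  assignment : ℕ → List Lit
  assignment j = assigned (blocks j)

  ∈-assignment⁻ : ∀ j {k} → k ∈ assignment j → Σ[ κ ∈ Kind ] Σ[ i ∈ ℕ ] (i < j × k ≡ L κ i true)
  ∈-assignment⁻ (suc j) m rewrite assigned-++ (blocks j) (block j) with ∈-++⁻ (assignment j) m
  ... | inj₁ m′ with ∈-assignment⁻ j m′
  ...   | κ , i , i<j , e = κ , i , m<n⇒m<1+n i<j , e
  ∈-assignment⁻ (suc j) m | inj₂ (here e)                 = KX , j , ≤-refl , e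
  ∈-assignment⁻ (suc j) m | inj₂ (there (here e))         = KU , j , ≤-refl , e
  ∈-assignment⁻ (suc j) m | inj₂ (there (there (here e))) = KT , j , ≤-refl , e

  ∈-assignment⁺ : ∀ κ {i} j → i < j → L κ i true ∈ assignment j
  ∈-assignment⁺ κ {i} (suc j) i<1+j rewrite assigned-++ (blocks j) (block j) with m<1+n⇒m<n∨m≡n i<1+j
  ... | inj₁ i<j  = ∈-++⁺ˡ (∈-assignment⁺ κ j i<j)
  ... | inj₂ refl = ∈-++⁺ʳ (assignment j) (in-block κ)
    where
    in-block : ∀ κ → L κ i true ∈ assigned (block i)
    in-block KX = here refl
    in-block KU = there (here refl)
    in-block KT = there (there (here refl))

  Distinct : Lit → List Lit → Set
  Distinct a τ = All (λ k → a ≡ k → ⊥) τ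

  -- The literals assigned by the first j blocks are positive and have index below j.
  ∉-assignment : ∀ κ {i} b j → i < n → j ≤ n → (b ≡ false ⊎ j ≤ i) → ∀ k → k ∈ assignment j → L κ i b ≡ k → ⊥
  ∉-assignment κ {i} b j i<n j≤n unassigned k m e with ∈-assignment⁻ j m
  ... | κ′ , i′ , i′<j , refl with L-inj {κ} {κ′} {i} {i′} i<n (<-≤-trans i′<j j≤n) e
  ...   | _ , refl , refl with unassigned
  ...     | inj₁ ()
  ...     | inj₂ j≤i = <-irrefl refl (<-≤-trans i′<j j≤i)

  unassigned : ∀ κ i b j τ → i < n → j ≤ n → (b ≡ false ⊎ j ≤ i) → Distinct (L κ i b) τ →
    (L κ i b ∈ᴸ (assignment j ++ τ)) ≡ false
  unassigned κ i b j τ i<n j≤n c distinct = ∈ᴸ-false (assignment j ++ τ) not-in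
    where
    not-in : ∀ k → k ∈ assignment j ++ τ → L κ i b ≡ k → ⊥
    not-in k m with ∈-++⁻ (assignment j) m
    ... | inj₁ m₁ = ∉-assignment κ b j i<n j≤n c k m₁
    ... | inj₂ m₂ = All.lookup distinct m₂

  live : ∀ κ i b j τ → i < n → j ≤ n → (not b ≡ false ⊎ j ≤ i) → Distinct (L κ i (not b)) τ →
    Live (assignment j ++ τ) (L κ i b)
  live κ i b = unassigned κ i (not b)

  sat-assignment : ∀ κ {i} j τ → i < j → (L κ i true ∈ᴸ (assignment j ++ τ)) ≡ true
  sat-assignment κ j τ i<j = ∈ᴸ-true (assignment j ++ τ) (∈-++⁺ˡ (∈-assignment⁺ κ j i<j))

  sat-τ : ∀ {a} j τ → a ∈ τ → (a ∈ᴸ (assignment j ++ τ)) ≡ true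
  sat-τ j τ m = ∈ᴸ-true (assignment j ++ τ) (∈-++⁺ʳ (assignment j) m)

  var-free : ∀ κ i b j τ → i < n → j ≤ n → j ≤ i → All (λ k → var k ≡ code κ i → ⊥) τ →
    VarFree P (assignment j ++ τ) (L κ i b)
  var-free κ i b j τ i<n j≤n j≤i distinct k m e with ∈-++⁻ (assignment j) m
  ... | inj₂ m₂ = All.lookup distinct m₂ e
  ... | inj₁ m₁ with ∈-assignment⁻ j m₁
  ...   | κ′ , i′ , i′<j , refl with code-inj {κ′} {κ} {i′} {i} (<-≤-trans i′<j j≤n) i<n e
  ...     | _ , refl = <-irrefl refl (<-≤-trans i′<j j≤i)

  ¬Unit-two : ∀ σ {C} κ₁ i₁ b₁ κ₂ i₂ b₂ → i₁ < n → i₂ < n → L κ₁ i₁ b₁ ∈ C → L κ₂ i₂ b₂ ∈ C →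
    Live σ (L κ₁ i₁ b₁) → Live σ (L κ₂ i₂ b₂) → (L κ₁ i₁ b₁ ≡ L κ₂ i₂ b₂ → ⊥) →
    unK κ₁ ≡ false → (unK κ₂ ≡ false ⊎ (exK κ₁ ≡ true × lvK κ₂ < lvK κ₁)) → Unit P σ C → ⊥
  ¬Unit-two σ κ₁ i₁ b₁ κ₂ i₂ b₂ h₁ h₂ m₁ m₂ l₁ l₂ ne u₁ c =
    ¬Unit-two-survivors P σ m₁ m₂ l₁ l₂ ne (trans (isUn-L κ₁ b₁ h₁) u₁) (second c)
    where
    second : _ →
      isUn P (L κ₂ i₂ b₂) ≡ false ⊎ (isEx P (L κ₁ i₁ b₁) ≡ true × lv P (L κ₂ i₂ b₂) < lv P (L κ₁ i₁ b₁))
    second (inj₁ u₂)       = inj₁ (trans (isUn-L κ₂ b₂ h₂) u₂)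
    second (inj₂ (e , lt)) =
      inj₂ (trans (isEx-L κ₁ b₁ h₁) e , subst₂ _<_ (sym (lv-L κ₂ b₂ h₂)) (sym (lv-L κ₁ b₁ h₁)) lt)

  ¬Empty-one : ∀ σ {C} κ i b → i < n → L κ i b ∈ C → Live σ (L κ i b) → unK κ ≡ false → EmptyReduct P σ C → ⊥
  ¬Empty-one σ κ i b i<n m l u = ¬EmptyReduct-survivor P σ m l (trans (isUn-L κ b i<n) u)

module Replay (n' : ℕ) where
  open Literals n'
  open Blocks n'

  -- M_m = t̄_0 ∨ … ∨ t̄_m ∨ U and A_m = t̄_0 ∨ … ∨ t̄_(m-1) ∨ x̄_m ∨ U′, with U, U′ universal literals
  -- of index > m, resp. ≥ m; these are the clauses learned in the m-th round.
  MLit ALit : ℕ → Lit → Set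
  MLit m y = (Σ[ i ∈ ℕ ] (i ≤ m × y ≡ L KT i false)) ⊎ (Σ[ i ∈ ℕ ] Σ[ b ∈ Bool ] (m < i × i < n × y ≡ L KU i b))
  ALit m y = (Σ[ i ∈ ℕ ] (i < m × y ≡ L KT i false)) ⊎ y ≡ L KX m false ⊎
             (Σ[ i ∈ ℕ ] Σ[ b ∈ Bool ] (m ≤ i × i < n × y ≡ L KU i b))

  record MClause (m : ℕ) (C : Clause) : Set where
    field
      t̄∈      : ∀ i → i ≤ m → L KT i false ∈ C
      u-index : ℕ
      u-pol   : Bool
      m<u     : m < u-index
      u<n     : u-index < n
      u∈      : L KU u-index u-pol ∈ C
      shape   : ∀ y → y ∈ C → MLit m y

  record AClause (m : ℕ) (C : Clause) : Set where
    field
      t̄∈    : ∀ i → i < m → L KT i false ∈ C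
      x̄∈    : L KX m false ∈ C
      shape : ∀ y → y ∈ C → ALit m y

  -- The clauses present while the j-th block is being replayed.
  data Known (j : ℕ) (C : Clause) : Set where
    known-t    : C ≡ tClause → Known j C
    known-pair : ∀ b i → i < n → C ≡ pairClause b i → Known j C
    known-M    : ∀ m → j ≤ m → m < n' → MClause m C → Known j C
    known-A    : ∀ m → j < m → m < n' → AClause m C → Known j C

  Known-mono : ∀ {j k C} → j ≤ k → Known k C → Known j C
  Known-mono j≤k (known-t e)               = known-t e
  Known-mono j≤k (known-pair b i i<n e)    = known-pair b i i<n e
  Known-mono j≤k (known-M m k≤m m<n′ d)    = known-M m (≤-trans j≤k k≤m) m<n′ d
  Known-mono j≤k (known-A m k<m m<n′ d)    = known-A m (≤-<-trans j≤k k<m) m<n′ d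

  Mat-known : ∀ {j C} → C ∈ Mat → Known j C
  Mat-known m with ∈-Mat⁻ m
  ... | inj₁ e                 = known-t e
  ... | inj₂ (b , i , i<n , e) = known-pair b i i<n e

  -- In the second trail of round j, x̄_j is propagated from A_j, which is then known as well.
  KnownX : ℕ → Bool → Clause → Set
  KnownX j b C = Known j C ⊎ (b ≡ false × AClause j C)

  n'<n : n' < n
  n'<n = ≤-refl

  1<2 : 1 < 2
  1<2 = s≤s (s≤s z≤n)

  2<3 : 2 < 3
  2<3 = s≤s (s≤s (s≤s z≤n))

  -- Replaying block j neither propagates nor conflicts before t_j: every known clause is satisfied or
  -- keeps two open literals (one, for the emptiness checks), of which a universal one is blocked by a later t̄.
  module _ (j : ℕ) (j<n' : j < n') where

    private
      j<n : j < n
      j<n = <-trans j<n' n'<n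
      j≤n : j ≤ n
      j≤n = <⇒≤ j<n
      σ₀ : List Lit
      σ₀ = assignment j ++ []
      σˣ σᵘ : Bool → List Lit
      σˣ b = assignment j ++ L KX j b ∷ []
      σᵘ b = assignment j ++ L KX j b ∷ L KU j b ∷ []

    no-unit-at-start : ∀ {C} → Known j C → Unit P σ₀ C → ⊥
    no-unit-at-start (known-t refl) =
      ¬Unit-two σ₀ KT j false KT n' false j<n n'<n (∈-tClause j<n) (∈-tClause n'<n)
        (live KT j false j [] j<n j≤n (inj₂ ≤-refl) []) (live KT n' false j [] n'<n j≤n (inj₂ (<⇒≤ j<n')) [])
        (≢-index KT j KT n' j<n n'<n (<⇒≢ j<n')) refl (inj₁ refl)
    no-unit-at-start (known-pair b i i<n refl) with i <? j
    ... | yes i<j = ¬Unit-satisfied P σ₀ (there (there (here refl))) (sat-assignment KT j [] i<j)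
    ... | no  i≮j = ¬Unit-two σ₀ KX i b KT i true i<n i<n (here refl) (there (there (here refl)))
      (live KX i b j [] i<n j≤n (inj₂ (≮⇒≥ i≮j)) []) (live KT i true j [] i<n j≤n (inj₁ refl) [])
      (≢-kind KX i KT i i<n i<n (λ ())) refl (inj₁ refl)
    no-unit-at-start (known-M m j≤m m<n' d) with m≤n⇒m<n∨m≡n j≤m
    ... | inj₁ j<m = ¬Unit-two σ₀ KT j false KT m false j<n m<n (MClause.t̄∈ d j j≤m) (MClause.t̄∈ d m ≤-refl)
      (live KT j false j [] j<n j≤n (inj₂ ≤-refl) []) (live KT m false j [] m<n j≤n (inj₂ j≤m) [])
      (≢-index KT j KT m j<n m<n (<⇒≢ j<m)) refl (inj₁ refl)
      where m<n = <-trans m<n' n'<n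
    ... | inj₂ refl = ¬Unit-two σ₀ KT j false KU u c j<n u<n (MClause.t̄∈ d j j≤m) (MClause.u∈ d)
      (live KT j false j [] j<n j≤n (inj₂ ≤-refl) []) (live KU u c j [] u<n j≤n (inj₂ (<⇒≤ (MClause.m<u d))) [])
      (≢-kind KT j KU u j<n u<n (λ ())) refl (inj₂ (refl , 2<3))
      where open MClause d renaming (u-index to u; u-pol to c)
    no-unit-at-start (known-A m j<m m<n' d) = ¬Unit-two σ₀ KX m false KT j false m<n j<n (AClause.x̄∈ d) (AClause.t̄∈ d j j<m)
      (live KX m false j [] m<n j≤n (inj₂ (<⇒≤ j<m)) []) (live KT j false j [] j<n j≤n (inj₂ ≤-refl) [])
      (≢-kind KX m KT j m<n j<n (λ ())) refl (inj₁ refl)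
      where m<n = <-trans m<n' n'<n

    no-unit-after-x : ∀ b {C} → KnownX j b C → Unit P (σˣ b) C → ⊥
    no-unit-after-x b (inj₁ (known-t refl)) =
      ¬Unit-two (σˣ b) KT j false KT n' false j<n n'<n (∈-tClause j<n) (∈-tClause n'<n)
        (live KT j false j _ j<n j≤n (inj₂ ≤-refl) (≢-kind KT j KX j j<n j<n (λ ()) ∷ []))
        (live KT n' false j _ n'<n j≤n (inj₂ (<⇒≤ j<n')) (≢-kind KT n' KX j n'<n j<n (λ ()) ∷ []))
        (≢-index KT j KT n' j<n n'<n (<⇒≢ j<n')) refl (inj₁ refl)
    no-unit-after-x b (inj₁ (known-pair c i i<n refl)) with <-cmp i j
    ... | tri< i<j _ _ = ¬Unit-satisfied P (σˣ b) (there (there (here refl))) (sat-assignment KT j _ i<j)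
    ... | tri> _ _ j<i = ¬Unit-two (σˣ b) KX i c KT i true i<n i<n (here refl) (there (there (here refl)))
      (live KX i c j _ i<n j≤n (inj₂ (<⇒≤ j<i)) (≢-index KX i KX j i<n j<n (>⇒≢ j<i) ∷ []))
      (live KT i true j _ i<n j≤n (inj₁ refl) (≢-kind KT i KX j i<n j<n (λ ()) ∷ []))
      (≢-kind KX i KT i i<n i<n (λ ())) refl (inj₁ refl)
    ... | tri≈ _ refl _ with c ≟ᵇ b
    ...   | yes refl = ¬Unit-satisfied P (σˣ b) (here refl) (sat-τ j _ (here refl))
    ...   | no  c≢b  = ¬Unit-two (σˣ b) KT j true KU j c j<n j<n (there (there (here refl))) (there (here refl))
      (live KT j true j _ j<n j≤n (inj₁ refl) (≢-kind KT j KX j j<n j<n (λ ()) ∷ []))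
      (live KU j c j _ j<n j≤n (inj₂ ≤-refl) (≢-kind KU j KX j j<n j<n (λ ()) ∷ []))
      (≢-kind KT j KU j j<n j<n (λ ())) refl (inj₂ (refl , 2<3))
    no-unit-after-x b (inj₁ (known-M m j≤m m<n' d)) with m≤n⇒m<n∨m≡n j≤m
    ... | inj₁ j<m = ¬Unit-two (σˣ b) KT j false KT m false j<n m<n (MClause.t̄∈ d j j≤m) (MClause.t̄∈ d m ≤-refl)
      (live KT j false j _ j<n j≤n (inj₂ ≤-refl) (≢-kind KT j KX j j<n j<n (λ ()) ∷ []))
      (live KT m false j _ m<n j≤n (inj₂ j≤m) (≢-kind KT m KX j m<n j<n (λ ()) ∷ []))
      (≢-index KT j KT m j<n m<n (<⇒≢ j<m)) refl (inj₁ refl)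
      where m<n = <-trans m<n' n'<n
    ... | inj₂ refl = ¬Unit-two (σˣ b) KT j false KU u c j<n u<n (MClause.t̄∈ d j j≤m) (MClause.u∈ d)
      (live KT j false j _ j<n j≤n (inj₂ ≤-refl) (≢-kind KT j KX j j<n j<n (λ ()) ∷ []))
      (live KU u c j _ u<n j≤n (inj₂ (<⇒≤ (MClause.m<u d))) (≢-kind KU u KX j u<n j<n (λ ()) ∷ []))
      (≢-kind KT j KU u j<n u<n (λ ())) refl (inj₂ (refl , 2<3))
      where open MClause d renaming (u-index to u; u-pol to c)
    no-unit-after-x b (inj₁ (known-A m j<m m<n' d)) = ¬Unit-two (σˣ b) KX m false KT j false m<n j<n (AClause.x̄∈ d) (AClause.t̄∈ d j j<m)
      (live KX m false j _ m<n j≤n (inj₂ (<⇒≤ j<m)) (≢-index KX m KX j m<n j<n (>⇒≢ j<m) ∷ []))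
      (live KT j false j _ j<n j≤n (inj₂ ≤-refl) (≢-kind KT j KX j j<n j<n (λ ()) ∷ []))
      (≢-kind KX m KT j m<n j<n (λ ())) refl (inj₁ refl)
      where m<n = <-trans m<n' n'<n
    no-unit-after-x .false (inj₂ (refl , d)) = ¬Unit-satisfied P (σˣ false) (AClause.x̄∈ d) (sat-τ j _ (here refl))

    no-empty-after-u : ∀ b {C} → KnownX j b C → EmptyReduct P (σᵘ b) C → ⊥
    no-empty-after-u b (inj₁ (known-t refl)) = ¬Empty-one (σᵘ b) KT j false j<n (∈-tClause j<n)
      (live KT j false j _ j<n j≤n (inj₂ ≤-refl) (≢-kind KT j KX j j<n j<n (λ ()) ∷ ≢-kind KT j KU j j<n j<n (λ ()) ∷ [])) refl
    no-empty-after-u b (inj₁ (known-pair c i i<n refl)) with <-cmp i j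
    ... | tri< i<j _ _ = ¬EmptyReduct-satisfied P (σᵘ b) (there (there (here refl))) (sat-assignment KT j _ i<j)
    ... | tri> _ _ j<i = ¬Empty-one (σᵘ b) KX i c i<n (here refl)
      (live KX i c j _ i<n j≤n (inj₂ (<⇒≤ j<i))
        (≢-index KX i KX j i<n j<n (>⇒≢ j<i) ∷ ≢-kind KX i KU j i<n j<n (λ ()) ∷ [])) refl
    ... | tri≈ _ refl _ with c ≟ᵇ b
    ...   | yes refl = ¬EmptyReduct-satisfied P (σᵘ b) (here refl) (sat-τ j _ (here refl))
    ...   | no  c≢b  = ¬Empty-one (σᵘ b) KT j true j<n (there (there (here refl)))
      (live KT j true j _ j<n j≤n (inj₁ refl) (≢-kind KT j KX j j<n j<n (λ ()) ∷ ≢-kind KT j KU j j<n j<n (λ ()) ∷ [])) refl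
    no-empty-after-u b (inj₁ (known-M m j≤m m<n' d)) = ¬Empty-one (σᵘ b) KT j false j<n (MClause.t̄∈ d j j≤m)
      (live KT j false j _ j<n j≤n (inj₂ ≤-refl) (≢-kind KT j KX j j<n j<n (λ ()) ∷ ≢-kind KT j KU j j<n j<n (λ ()) ∷ [])) refl
    no-empty-after-u b (inj₁ (known-A m j<m m<n' d)) = ¬Empty-one (σᵘ b) KX m false m<n (AClause.x̄∈ d)
      (live KX m false j _ m<n j≤n (inj₂ (<⇒≤ j<m))
        (≢-index KX m KX j m<n j<n (>⇒≢ j<m) ∷ ≢-kind KX m KU j m<n j<n (λ ()) ∷ [])) refl
      where m<n = <-trans m<n' n'<n
    no-empty-after-u .false (inj₂ (refl , d)) = ¬EmptyReduct-satisfied P (σᵘ false) (AClause.x̄∈ d) (sat-τ j _ (here refl))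

  no-empty-at-start : ∀ j {C} → j ≤ n' → Known j C ⊎ AClause j C → EmptyReduct P (assignment j ++ []) C → ⊥
  no-empty-at-start j j≤n' (inj₁ (known-t refl)) = ¬Empty-one (assignment j ++ []) KT j false j<n (∈-tClause j<n)
    (live KT j false j [] j<n (<⇒≤ j<n) (inj₂ ≤-refl) []) refl
    where j<n = s≤s j≤n'
  no-empty-at-start j j≤n' (inj₁ (known-pair b i i<n refl)) with i <? j
  ... | yes i<j = ¬EmptyReduct-satisfied P (assignment j ++ []) (there (there (here refl))) (sat-assignment KT j [] i<j)
  ... | no  i≮j = ¬Empty-one (assignment j ++ []) KX i b i<n (here refl)
    (live KX i b j [] i<n (<⇒≤ (s≤s j≤n')) (inj₂ (≮⇒≥ i≮j)) []) refl
  no-empty-at-start j j≤n' (inj₁ (known-M m j≤m m<n' d)) = ¬Empty-one (assignment j ++ []) KT j false j<n (MClause.t̄∈ d j j≤m)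
    (live KT j false j [] j<n (<⇒≤ j<n) (inj₂ ≤-refl) []) refl
    where j<n = s≤s j≤n'
  no-empty-at-start j j≤n' (inj₁ (known-A m j<m m<n' d)) = ¬Empty-one (assignment j ++ []) KX m false m<n (AClause.x̄∈ d)
    (live KX m false j [] m<n (<⇒≤ (s≤s j≤n')) (inj₂ (<⇒≤ j<m)) []) refl
    where m<n = <-trans m<n' n'<n
  no-empty-at-start j j≤n' (inj₂ d) = ¬Empty-one (assignment j ++ []) KX j false j<n (AClause.x̄∈ d)
    (live KX j false j [] j<n (<⇒≤ j<n) (inj₂ ≤-refl) []) refl
    where j<n = s≤s j≤n'

  no-empty-after-t̄ : ∀ {C} → C ∈ Mat → EmptyReduct P (assignment n' ++ L KT n' false ∷ []) C → ⊥
  no-empty-after-t̄ m with ∈-Mat⁻ m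
  ... | inj₁ refl = ¬EmptyReduct-satisfied P (assignment n' ++ L KT n' false ∷ []) (∈-tClause n'<n) (sat-τ n' _ (here refl))
  ... | inj₂ (b , i , i<n , refl) with i <? n'
  ...   | yes i<n' = ¬EmptyReduct-satisfied P (assignment n' ++ L KT n' false ∷ []) (there (there (here refl))) (sat-assignment KT n' _ i<n')
  ...   | no  i≮n' = ¬Empty-one (assignment n' ++ L KT n' false ∷ []) KX i b i<n (here refl)
    (live KX i b n' _ i<n (<⇒≤ n'<n) (inj₂ (≮⇒≥ i≮n')) (≢-kind KX i KT n' i<n n'<n (λ ()) ∷ [])) refl

module Learning (n' : ℕ) where
  open Literals n'
  open Replay n'

  ∈-red-L : ∀ κ i b {D} → i < n → unK κ ≡ false → L κ i b ∈ D → L κ i b ∈ red P D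
  ∈-red-L κ i b i<n un m = ∈-red-nonuniversal P m (trans (isUn-L κ b i<n) un)

  ∈-red-u : ∀ i b j c {D} → i < n → j < n → L KU i b ∈ D → L KT j c ∈ D → L KU i b ∈ red P D
  ∈-red-u i b j c i<n j<n u∈ t∈ =
    ∈-red-dominated P u∈ t∈ (isEx-L KT c j<n) (subst₂ _<_ (sym (lv-L KU b i<n)) (sym (lv-L KT c j<n)) 2<3)

  -- The clauses derived from the conflicts of the trails of round m and of the first trail.
  learnA : ℕ → Clause → Clause
  learnA m M = red P (resolve (L KT m false) (red P M) (red P (negClause m)))

  resolvent₁ reduced₁ resolvent₂ learnM : ℕ → Clause → Clause
  resolvent₁ m M = resolve (L KT m false) (red P M) (red P (posClause m))
  reduced₁   m M = red P (resolvent₁ m M)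
  resolvent₂ m M = resolve (L KX m true) (reduced₁ m M) (red P (learnA m M))
  learnM     m M = red P (resolvent₂ m M)

  top₁ topReduced₁ top₂ Mtop : Clause
  top₁        = resolve (L KX n' true) (red P (posClause n')) (red P (negClause n'))
  topReduced₁ = red P top₁
  top₂        = resolve (L KT n' true) topReduced₁ (red P tClause)
  Mtop        = red P top₂

  RLit : ℕ → Lit → Set
  RLit m y = (Σ[ i ∈ ℕ ] (i < m × y ≡ L KT i false)) ⊎ (Σ[ i ∈ ℕ ] Σ[ b ∈ Bool ] (m ≤ i × i < n × y ≡ L KU i b))

  MLit⇒RLit : ∀ m y → (y ≡ L KT m false → ⊥) → MLit m y → RLit m y
  MLit⇒RLit m y y≢t̄ (inj₁ (i , i≤m , refl)) with m≤n⇒m<n∨m≡n i≤m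
  ... | inj₁ i<m  = inj₁ (i , i<m , refl)
  ... | inj₂ refl = ⊥-elim (y≢t̄ refl)
  MLit⇒RLit m y y≢t̄ (inj₂ (i , b , m<i , i<n , e)) = inj₂ (i , b , <⇒≤ m<i , i<n , e)

  ALit⇒RLit : ∀ m y → (y ≡ L KX m false → ⊥) → ALit m y → RLit m y
  ALit⇒RLit m y y≢x̄ (inj₁ t̄)         = inj₁ t̄
  ALit⇒RLit m y y≢x̄ (inj₂ (inj₁ e))  = ⊥-elim (y≢x̄ e)
  ALit⇒RLit m y y≢x̄ (inj₂ (inj₂ u))  = inj₂ u

  RLit⇒ALit : ∀ m y → RLit m y → ALit m y
  RLit⇒ALit m y (inj₁ t̄) = inj₁ t̄
  RLit⇒ALit m y (inj₂ u) = inj₂ (inj₂ u)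

  RLit-suc⇒MLit : ∀ k y → RLit (suc k) y → MLit k y
  RLit-suc⇒MLit k y (inj₁ (i , i<1+k , e))         = inj₁ (i , ≤-pred i<1+k , e)
  RLit-suc⇒MLit k y (inj₂ (i , b , 1+k≤i , i<n , e)) = inj₂ (i , b , 1+k≤i , i<n , e)

  negClause-ALit : ∀ m y → m < n → (y ≡ L KT m true → ⊥) → y ∈ negClause m → ALit m y
  negClause-ALit m y m<n y≢t (here e)                 = inj₂ (inj₁ e)
  negClause-ALit m y m<n y≢t (there (here e))         = inj₂ (inj₂ (m , false , ≤-refl , m<n , e))
  negClause-ALit m y m<n y≢t (there (there (here e))) = ⊥-elim (y≢t e)

  posClause-RLit : ∀ m y → m < n → (y ≡ L KT m true → ⊥) → (y ≡ L KX m true → ⊥) → y ∈ posClause m → RLit m y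
  posClause-RLit m y m<n y≢t y≢x (here e)                 = ⊥-elim (y≢x e)
  posClause-RLit m y m<n y≢t y≢x (there (here e))         = inj₂ (m , true , ≤-refl , m<n , e)
  posClause-RLit m y m<n y≢t y≢x (there (there (here e))) = ⊥-elim (y≢t e)

  -- Without any t̄ left nothing blocks the universal literals.
  red-RLit-zero : ∀ D → (∀ y → y ∈ D → RLit 0 y) → red P D ≡ []
  red-RLit-zero D shape = ∀∉⇒≡[] (red P D) ∉red
    where
    universal : ∀ y → RLit 0 y → isUn P y ≡ true × isEx P y ≡ false
    universal y (inj₂ (i , b , _ , i<n , refl)) = isUn-L KU b i<n , isEx-L KU b i<n
    ∉red : ∀ y → y ∈ red P D → ⊥
    ∉red y y∈ = ∉-red-undominated P y∈ (proj₁ (universal y (shape y (red-⊆ P y∈))))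
      (λ x x∈ → inj₁ (proj₂ (universal x (shape x x∈))))

  learnA-shape : ∀ m M → m < n' → MClause m M → AClause m (learnA m M)
  learnA-shape m M m<n' d = record { t̄∈ = t̄∈A ; x̄∈ = x̄∈A ; shape = shape }
    where
    m<n = <-trans m<n' n'<n
    R = resolve (L KT m false) (red P M) (red P (negClause m))
    t̄∈A : ∀ i → i < m → L KT i false ∈ learnA m M
    t̄∈A i i<m = ∈-red-L KT i false {R} i<n refl
      (∈-resolveˡ {L KT m false} {red P M} {red P (negClause m)} (∈-red-L KT i false {M} i<n refl (MClause.t̄∈ d i (<⇒≤ i<m)))
        (≢-index KT i KT m i<n m<n (<⇒≢ i<m)))
      where i<n = <-trans i<m m<n
    x̄∈A : L KX m false ∈ learnA m M
    x̄∈A = ∈-red-L KX m false {R} m<n refl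
      (∈-resolveʳ {L KT m false} {red P M} {red P (negClause m)} (∈-red-L KX m false {negClause m} m<n refl (here refl))
        (≢-kind KX m KT m m<n m<n (λ ())))
    shape : ∀ y → y ∈ learnA m M → ALit m y
    shape y y∈ =
      [ (λ (y∈M , y≢t̄) → RLit⇒ALit m y (MLit⇒RLit m y y≢t̄ (MClause.shape d y (red-⊆ P {M} y∈M))))
      , (λ (y∈N , y≢t) → negClause-ALit m y m<n y≢t (red-⊆ P {negClause m} y∈N))
      ]′ (∈-resolve⁻ {L KT m false} {red P M} {red P (negClause m)} (red-⊆ P {R} y∈))

  resolvent₂-shape : ∀ m M → m < n' → MClause m M → ∀ y → y ∈ resolvent₂ m M → RLit m y
  resolvent₂-shape m M m<n' d y y∈ =
    [ (λ (y∈R₁ , y≢x) →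
        [ (λ (y∈M , y≢t̄) → MLit⇒RLit m y y≢t̄ (MClause.shape d y (red-⊆ P {M} y∈M)))
        , (λ (y∈P , y≢t) → posClause-RLit m y (<-trans m<n' n'<n) y≢t y≢x (red-⊆ P {posClause m} y∈P))
        ]′ (∈-resolve⁻ {L KT m false} {red P M} {red P (posClause m)} (red-⊆ P {resolvent₁ m M} y∈R₁)))
    , (λ (y∈A , y≢x̄) → ALit⇒RLit m y y≢x̄ (AClause.shape (learnA-shape m M m<n' d) y (red-⊆ P {learnA m M} y∈A)))
    ]′ (∈-resolve⁻ {L KX m true} {reduced₁ m M} {red P (learnA m M)} y∈)

  t̄∈resolvent₂ : ∀ m M → m < n' → MClause m M → ∀ i → i < m → L KT i false ∈ resolvent₂ m M
  t̄∈resolvent₂ m M m<n' d i i<m =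
    ∈-resolveˡ {L KX m true} {reduced₁ m M} {red P (learnA m M)}
      (∈-red-L KT i false {resolvent₁ m M} i<n refl
        (∈-resolveˡ {L KT m false} {red P M} {red P (posClause m)}
          (∈-red-L KT i false {M} i<n refl (MClause.t̄∈ d i (<⇒≤ i<m))) (≢-index KT i KT m i<n m<n (<⇒≢ i<m))))
      (≢-kind KT i KX m i<n m<n (λ ()))
    where
    m<n = <-trans m<n' n'<n
    i<n = <-trans i<m m<n

  -- The universal literal u of M survives every reduction because t̄_0 stays in each resolvent.
  learnM-shape : ∀ k M → suc k < n' → MClause (suc k) M → MClause k (learnM (suc k) M)
  learnM-shape k M m<n' d = record
    { t̄∈ = λ i i≤k → ∈-red-L KT i false {resolvent₂ m M} (<-trans (s≤s i≤k) m<n) refl (t̄∈resolvent₂ m M m<n' d i (s≤s i≤k))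
    ; u-index = u ; u-pol = b ; m<u = <-trans (n<1+n k) (MClause.m<u d) ; u<n = u<n ; u∈ = u∈M′
    ; shape = λ y y∈ → RLit-suc⇒MLit k y (resolvent₂-shape m M m<n' d y (red-⊆ P {resolvent₂ m M} y∈))
    }
    where
    open MClause d using (u<n) renaming (u-index to u; u-pol to b)
    m = suc k
    m<n = <-trans m<n' n'<n
    0<n : 0 < n
    0<n = s≤s z≤n
    t̄₀∈R₁ : L KT 0 false ∈ resolvent₁ m M
    t̄₀∈R₁ = ∈-resolveˡ {L KT m false} {red P M} {red P (posClause m)}
      (∈-red-L KT 0 false {M} 0<n refl (MClause.t̄∈ d 0 z≤n)) (≢-index KT 0 KT m 0<n m<n (λ ()))
    u∈R₁ : L KU u b ∈ resolvent₁ m M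
    u∈R₁ = ∈-resolveˡ {L KT m false} {red P M} {red P (posClause m)}
      (∈-red-u u b 0 false {M} u<n 0<n (MClause.u∈ d) (MClause.t̄∈ d 0 z≤n)) (≢-kind KU u KT m u<n m<n (λ ()))
    u∈R₂ : L KU u b ∈ resolvent₂ m M
    u∈R₂ = ∈-resolveˡ {L KX m true} {reduced₁ m M} {red P (learnA m M)}
      (∈-red-u u b 0 false {resolvent₁ m M} u<n 0<n u∈R₁ t̄₀∈R₁) (≢-kind KU u KX m u<n m<n (λ ()))
    u∈M′ : L KU u b ∈ learnM m M
    u∈M′ = ∈-red-u u b 0 false {resolvent₂ m M} u<n 0<n u∈R₂ (t̄∈resolvent₂ m M m<n' d 0 (s≤s z≤n))

  learnM-zero : ∀ M → 0 < n' → MClause 0 M → learnM 0 M ≡ []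
  learnM-zero M 0<n' d = red-RLit-zero (resolvent₂ 0 M) (resolvent₂-shape 0 M 0<n' d)

  top₂-shape : ∀ y → y ∈ top₂ → RLit n' y
  top₂-shape y y∈ =
    [ (λ (y∈R₁ , y≢t) →
        [ (λ (y∈P , y≢x) → posClause-RLit n' y n'<n y≢t y≢x (red-⊆ P {posClause n'} y∈P))
        , (λ (y∈N , y≢x̄) → ALit⇒RLit n' y y≢x̄ (negClause-ALit n' y n'<n y≢t (red-⊆ P {negClause n'} y∈N)))
        ]′ (∈-resolve⁻ {L KX n' true} {red P (posClause n')} {red P (negClause n')} (red-⊆ P {top₁} y∈R₁)))
    , (λ (y∈T , y≢t̄) → t̄-below-n' y≢t̄ (∈-tClause⁻ (red-⊆ P {tClause} y∈T)))
    ]′ (∈-resolve⁻ {L KT n' true} {topReduced₁} {red P tClause} y∈)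
    where
    t̄-below-n' : (y ≡ L KT n' false → ⊥) → Σ[ i ∈ ℕ ] (i < n × y ≡ L KT i false) → RLit n' y
    t̄-below-n' y≢t̄ (i , i<n , e) with m<1+n⇒m<n∨m≡n i<n
    ... | inj₁ i<n' = inj₁ (i , i<n' , e)
    ... | inj₂ refl = ⊥-elim (y≢t̄ e)

  t∈top₁ : L KT n' true ∈ top₁
  t∈top₁ = ∈-resolveˡ {L KX n' true} {red P (posClause n')} {red P (negClause n')}
    (∈-red-L KT n' true {posClause n'} n'<n refl (there (there (here refl)))) (≢-kind KT n' KX n' n'<n n'<n (λ ()))

  x∈posClause : (L KX n' true ∈ᴸ red P (posClause n')) ≡ true
  x∈posClause = ∈ᴸ-true (red P (posClause n')) (∈-red-L KX n' true {posClause n'} n'<n refl (here refl))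

  t∈topReduced₁ : (L KT n' true ∈ᴸ topReduced₁) ≡ true
  t∈topReduced₁ = ∈ᴸ-true topReduced₁ (∈-red-L KT n' true {top₁} n'<n refl t∈top₁)

  Mtop-shape : ∀ k → suc k ≡ n' → MClause k Mtop
  Mtop-shape k 1+k≡n' = record
    { t̄∈ = t̄∈Mtop ; u-index = n' ; u-pol = true ; m<u = k<n' ; u<n = n'<n ; u∈ = u∈Mtop
    ; shape = λ y y∈ → RLit-suc⇒MLit k y (subst (λ j → RLit j y) (sym 1+k≡n') (top₂-shape y (red-⊆ P {top₂} y∈)))
    }
    where
    k<n' : k < n'
    k<n' = ≤-reflexive 1+k≡n'
    0<n : 0 < n
    0<n = s≤s z≤n
    t̄∈top₂ : ∀ i → i < n' → L KT i false ∈ top₂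
    t̄∈top₂ i i<n' = ∈-resolveʳ {L KT n' true} {topReduced₁} {red P tClause}
      (∈-red-L KT i false {tClause} i<n refl (∈-tClause i<n)) (≢-index KT i KT n' i<n n'<n (<⇒≢ i<n'))
      where i<n = <-trans i<n' n'<n
    t̄∈Mtop : ∀ i → i ≤ k → L KT i false ∈ Mtop
    t̄∈Mtop i i≤k = ∈-red-L KT i false {top₂} (<-trans i<n' n'<n) refl (t̄∈top₂ i i<n')
      where i<n' = ≤-<-trans i≤k k<n'
    u∈topReduced₁ : L KU n' true ∈ topReduced₁
    u∈topReduced₁ = ∈-red-u n' true n' true {top₁} n'<n n'<n
      (∈-resolveˡ {L KX n' true} {red P (posClause n')} {red P (negClause n')}
        (∈-red-u n' true n' true {posClause n'} n'<n n'<n (there (here refl)) (there (there (here refl))))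
        (≢-kind KU n' KX n' n'<n n'<n (λ ())))
      t∈top₁
    u∈Mtop : L KU n' true ∈ Mtop
    u∈Mtop = ∈-red-u n' true 0 false {top₂} n'<n 0<n
      (∈-resolveˡ {L KT n' true} {topReduced₁} {red P tClause} u∈topReduced₁ (≢-kind KU n' KT n' n'<n n'<n (λ ())))
      (t̄∈top₂ 0 (≤-<-trans z≤n k<n'))

  Mtop-zero : 0 ≡ n' → Mtop ≡ []
  Mtop-zero 0≡n' = red-RLit-zero top₂ (λ y y∈ → subst (λ j → RLit j y) (sym 0≡n') (top₂-shape y y∈))

  t̄∈red-M : ∀ m M → m < n' → MClause m M → (L KT m false ∈ᴸ red P M) ≡ true
  t̄∈red-M m M m<n' d = ∈ᴸ-true (red P M) (∈-red-L KT m false {M} (<-trans m<n' n'<n) refl (MClause.t̄∈ d m ≤-refl))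

  x∈reduced₁ : ∀ m M → m < n' → (L KX m true ∈ᴸ reduced₁ m M) ≡ true
  x∈reduced₁ m M m<n' = ∈ᴸ-true (reduced₁ m M) (∈-red-L KX m true {resolvent₁ m M} m<n refl
    (∈-resolveʳ {L KT m false} {red P M} {red P (posClause m)} (∈-red-L KX m true {posClause m} m<n refl (here refl))
      (≢-kind KX m KT m m<n m<n (λ ()))))
    where m<n = <-trans m<n' n'<n

module Trails (n' : ℕ) where
  open Literals n'
  open Blocks n'
  open Replay n'
  open Learning n'

  legal-x : ∀ F j → j < n' → (∀ C → C ∈ F → Known j C) → Legal P F (blocks j ++ []) (dec (L KX j true))
  legal-x F j j<n' known =
    legal-decision P (blocks j ++ []) (assigned-++ (blocks j) []) (var-free KX j true j [] j<n (<⇒≤ j<n) ≤-refl [])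
      (Quantified.in-prefix (quantified KX j<n)) no-universal-left (λ C m u → no-unit-at-start j j<n' (known C m) u)
    where
    j<n = <-trans j<n' n'<n
    no-universal-left : isEx P (L KX j true) ≡ true → ∀ u → isUnVar P u ≡ true → lvVar P u < lv P (L KX j true) → ⊥
    no-universal-left _ u un lt with subst₂ _<_ (universal-lv u un) (lv-L KX true j<n) lt
    ... | s≤s ()

  legal-u : ∀ F j b pre → j < n' → assigned pre ≡ assignment j ++ L KX j b ∷ [] →
    (∀ C → C ∈ F → KnownX j b C) → Legal P F pre (dec (L KU j b))
  legal-u F j b pre j<n' eq known =
    legal-decision P pre eq (var-free KU j b j _ j<n (<⇒≤ j<n) ≤-refl (≢-var KX j KU j j<n j<n (λ ()) ∷ []))
      (Quantified.in-prefix (quantified KU j<n)) universal (λ C m u → no-unit-after-x j j<n' b (known C m) u)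
    where
    j<n = <-trans j<n' n'<n
    universal : isEx P (L KU j b) ≡ true → ∀ u → isUnVar P u ≡ true → lvVar P u < lv P (L KU j b) → ⊥
    universal ex with () ← trans (sym (isEx-L KU b j<n)) ex

  legal-t : ∀ F j b pre → j < n' → assigned pre ≡ assignment j ++ L KX j b ∷ L KU j b ∷ [] →
    (∀ C → C ∈ F → KnownX j b C) → pairClause (not b) j ∈ F → Legal P F pre (prop (L KT j true) (pairClause (not b) j))
  legal-t F j b pre j<n' eq known reason∈F =
    legal-propagation P pre eq
      (var-free KT j true j τ j<n j≤n ≤-refl (≢-var KX j KT j j<n j<n (λ ()) ∷ ≢-var KU j KT j j<n j<n (λ ()) ∷ []))
      (isEx-L KT true j<n) (isUn-L KT true j<n) reason∈F unsatisfied (there (there (here refl)))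
      (live KT j true j τ j<n j≤n (inj₁ refl) (≢-kind KT j KX j j<n j<n (λ ()) ∷ ≢-kind KT j KU j j<n j<n (λ ()) ∷ []))
      unit (λ C m e → no-empty-after-u j j<n' b (known C m) e)
    where
    j<n = <-trans j<n' n'<n
    j≤n = <⇒≤ j<n
    τ = L KX j b ∷ L KU j b ∷ []
    b≢not-b : b ≡ not b → ⊥
    b≢not-b = not-¬ refl
    unsatisfied : ∀ y → y ∈ pairClause (not b) j → (y ∈ᴸ (assignment j ++ τ)) ≡ false
    unsatisfied y (here refl) =
      unassigned KX j (not b) j τ j<n j≤n (inj₂ ≤-refl) (≢-polarity (b≢not-b ∘ sym) ∷ ≢-kind KX j KU j j<n j<n (λ ()) ∷ [])
    unsatisfied y (there (here refl)) =
      unassigned KU j (not b) j τ j<n j≤n (inj₂ ≤-refl) (≢-kind KU j KX j j<n j<n (λ ()) ∷ ≢-polarity (b≢not-b ∘ sym) ∷ [])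
    unsatisfied y (there (there (here refl))) =
      unassigned KT j true j τ j<n j≤n (inj₂ ≤-refl) (≢-kind KT j KX j j<n j<n (λ ()) ∷ ≢-kind KT j KU j j<n j<n (λ ()) ∷ [])
    unit : UnitFor P (assignment j ++ τ) (pairClause (not b) j) (L KT j true)
    unit y (here refl)                 = inj₂ (inj₁ (sat-τ j τ (here (cong (L KX j) (not-involutive b)))))
    unit y (there (here refl))         = inj₂ (inj₁ (sat-τ j τ (there (here (cong (L KU j) (not-involutive b))))))
    unit y (there (there (here refl))) = inj₁ refl

  legal-block : ∀ F j → j < n' → (∀ C → C ∈ F → Known j C) → negClause j ∈ F → LegalAfter P F (blocks j) (block j)
  legal-block F j j<n' known neg∈F =
    legalAfter₃ P (legal-x F j j<n' known)
      (legal-u F j true (blocks j ++ dec (L KX j true) ∷ []) j<n' (assigned-++ (blocks j) _) (λ C m → inj₁ (known C m)))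
      (legal-t F j true (blocks j ++ dec (L KX j true) ∷ dec (L KU j true) ∷ []) j<n' (assigned-++ (blocks j) _)
        (λ C m → inj₁ (known C m)) neg∈F)

  legal-blocks : ∀ F k → k ≤ n' → (∀ j → j < k → ∀ C → C ∈ F → Known j C) → (∀ {C} → C ∈ Mat → C ∈ F) →
    LegalPrefix P F (blocks k)
  legal-blocks F zero    _     _     _    = legal-[] P
  legal-blocks F (suc j) j<n' known Mat⊆F =
    legal-++ P (blocks j) (block j) (legal-blocks F j (<⇒≤ j<n') (λ i i<j → known i (m<n⇒m<1+n i<j)) Mat⊆F)
      (legal-block F j j<n' (known j ≤-refl) (Mat⊆F (pairClause∈Mat false (<-trans j<n' n'<n))))

  first-prefix : Trail
  first-prefix = blocks n' ++ prop (L KT n' false) tClause ∷ prop (L KX n' false) (negClause n') ∷ []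

  legal-t̄ : Legal P Mat (blocks n' ++ []) (prop (L KT n' false) tClause)
  legal-t̄ = legal-propagation P (blocks n' ++ []) (assigned-++ (blocks n') [])
    (var-free KT n' false n' [] n'<n n'≤n ≤-refl []) (isEx-L KT false n'<n) (isUn-L KT false n'<n) (here refl)
    unsatisfied (∈-tClause n'<n) (live KT n' false n' [] n'<n n'≤n (inj₂ ≤-refl) []) unit
    (λ C m e → no-empty-at-start n' ≤-refl (inj₁ (Mat-known m)) e)
    where
    n'≤n = <⇒≤ n'<n
    unsatisfied : ∀ y → y ∈ tClause → (y ∈ᴸ (assignment n' ++ [])) ≡ false
    unsatisfied y m with ∈-tClause⁻ m
    ... | i , i<n , refl = unassigned KT i false n' [] i<n n'≤n (inj₁ refl) []
    unit : UnitFor P (assignment n' ++ []) tClause (L KT n' false)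
    unit y m with ∈-tClause⁻ m
    ... | i , i<n , refl with m<1+n⇒m<n∨m≡n i<n
    ...   | inj₁ i<n' = inj₂ (inj₁ (sat-assignment KT n' [] i<n'))
    ...   | inj₂ refl = inj₁ refl

  legal-x̄ : Legal P Mat (blocks n' ++ prop (L KT n' false) tClause ∷ []) (prop (L KX n' false) (negClause n'))
  legal-x̄ = legal-propagation P (blocks n' ++ prop (L KT n' false) tClause ∷ []) (assigned-++ (blocks n') _)
    (var-free KX n' false n' τ n'<n n'≤n ≤-refl (≢-var KT n' KX n' n'<n n'<n (λ ()) ∷ []))
    (isEx-L KX false n'<n) (isUn-L KX false n'<n) (pairClause∈Mat false n'<n) unsatisfied (here refl)
    (live KX n' false n' τ n'<n n'≤n (inj₂ ≤-refl) (≢-kind KX n' KT n' n'<n n'<n (λ ()) ∷ [])) unit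
    (λ C m e → no-empty-after-t̄ m e)
    where
    n'≤n = <⇒≤ n'<n
    τ = L KT n' false ∷ []
    unsatisfied : ∀ y → y ∈ negClause n' → (y ∈ᴸ (assignment n' ++ τ)) ≡ false
    unsatisfied y (here refl) =
      unassigned KX n' false n' τ n'<n n'≤n (inj₁ refl) (≢-kind KX n' KT n' n'<n n'<n (λ ()) ∷ [])
    unsatisfied y (there (here refl)) =
      unassigned KU n' false n' τ n'<n n'≤n (inj₁ refl) (≢-kind KU n' KT n' n'<n n'<n (λ ()) ∷ [])
    unsatisfied y (there (there (here refl))) =
      unassigned KT n' true n' τ n'<n n'≤n (inj₂ ≤-refl) (≢-polarity (λ ()) ∷ [])
    unit : UnitFor P (assignment n' ++ τ) (negClause n') (L KX n' false)
    unit y (here refl)                 = inj₁ refl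
    unit y (there (here refl))         =
      inj₂ (inj₂ (isUn-L KU false n'<n , isEx-L KU false n'<n ,
                  subst₂ _<_ (sym (lv-L KX false n'<n)) (sym (lv-L KU false n'<n)) 1<2))
    unit y (there (there (here refl))) = inj₂ (inj₁ (sat-τ n' τ (here refl)))

  first-conflict : EntryOK P Mat first-prefix (confl (posClause n')) []
  first-conflict = conflict-ok P first-prefix (assigned-++ (blocks n') _) (pairClause∈Mat true n'<n) unsatisfied falsified
    where
    n'≤n = <⇒≤ n'<n
    τ = L KT n' false ∷ L KX n' false ∷ []
    unsatisfied : ∀ y → y ∈ posClause n' → (y ∈ᴸ (assignment n' ++ τ)) ≡ false
    unsatisfied y (here refl) = unassigned KX n' true n' τ n'<n n'≤n (inj₂ ≤-refl)
      (≢-kind KX n' KT n' n'<n n'<n (λ ()) ∷ ≢-polarity (λ ()) ∷ [])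
    unsatisfied y (there (here refl)) = unassigned KU n' true n' τ n'<n n'≤n (inj₂ ≤-refl)
      (≢-kind KU n' KT n' n'<n n'<n (λ ()) ∷ ≢-kind KU n' KX n' n'<n n'<n (λ ()) ∷ [])
    unsatisfied y (there (there (here refl))) = unassigned KT n' true n' τ n'<n n'≤n (inj₂ ≤-refl)
      (≢-polarity (λ ()) ∷ ≢-kind KT n' KX n' n'<n n'<n (λ ()) ∷ [])
    falsified : ∀ y → y ∈ posClause n' → (neg y ∈ᴸ (assignment n' ++ τ)) ≡ true ⊎ (isUn P y ≡ true × isEx P y ≡ false)
    falsified y (here refl)                 = inj₁ (sat-τ n' τ (there (here refl)))
    falsified y (there (here refl))         = inj₂ (isUn-L KU true n'<n , isEx-L KU true n'<n)
    falsified y (there (there (here refl))) = inj₁ (sat-τ n' τ (here refl))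

  first-step : Step P Mat nothing (first-prefix ∷ʳ confl (posClause n')) Mtop
  first-step = conflict-step P first-prefix nothing
    (legal-++ P (blocks n') _ (legal-blocks Mat n' ≤-refl (λ _ _ C m → Mat-known m) (λ m → m)) (legalAfter₂ P legal-t̄ legal-x̄))
    first-conflict
    (subst (λ es → Mtop ∈ learnSteps P es (red P (posClause n'))) (sym (reverse-++ (blocks n') _))
      (learnSteps-resolve P (L KX n' false) (negClause n') (prop (L KT n' false) tClause ∷ reverse (blocks n')) (red P (posClause n')) x∈posClause
        (learnSteps-resolve P (L KT n' false) tClause (reverse (blocks n')) topReduced₁ t∈topReduced₁
          (learnSteps-head P (reverse (blocks n')) Mtop))))

  record Round (m : ℕ) (F : List Clause) (M : Clause) : Set where
    field
      known   : ∀ C → C ∈ F → Known m C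
      Mat⊆    : ∀ {C} → C ∈ Mat → C ∈ F
      M∈      : M ∈ F
      M-shape : MClause m M

  A-trail : ℕ → Clause → Trail
  A-trail m M = blocks (suc m) ∷ʳ confl M

  A-conflict : ∀ m M F → m < n' → M ∈ F → MClause m M → EntryOK P F (blocks (suc m)) (confl M) []
  A-conflict m M F m<n' M∈F d =
    conflict-ok P (blocks (suc m)) (sym (++-identityʳ _)) M∈F
      (λ y y∈ → unsatisfied y (MClause.shape d y y∈)) (λ y y∈ → falsified y (MClause.shape d y y∈))
    where
    m<n = <-trans m<n' n'<n
    unsatisfied : ∀ y → MLit m y → (y ∈ᴸ (assignment (suc m) ++ [])) ≡ false
    unsatisfied y (inj₁ (i , i≤m , refl))          = unassigned KT i false (suc m) [] (≤-<-trans i≤m m<n) m<n (inj₁ refl) []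
    unsatisfied y (inj₂ (i , b , m<i , i<n , refl)) = unassigned KU i b (suc m) [] i<n m<n (inj₂ m<i) []
    falsified : ∀ y → MLit m y → (neg y ∈ᴸ (assignment (suc m) ++ [])) ≡ true ⊎ (isUn P y ≡ true × isEx P y ≡ false)
    falsified y (inj₁ (i , i≤m , refl))          = inj₁ (sat-assignment KT (suc m) [] (s≤s i≤m))
    falsified y (inj₂ (i , b , m<i , i<n , refl)) = inj₂ (isUn-L KU b i<n , isEx-L KU b i<n)

  A-step : ∀ m F M prev → m < n' → Round m F M → Step P F prev (A-trail m M) (learnA m M)
  A-step m F M prev m<n' round = conflict-step P (blocks (suc m)) prev
    (legal-blocks F (suc m) m<n' (λ j j<1+m C C∈ → Known-mono (≤-pred j<1+m) (known C C∈)) Mat⊆)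
    (A-conflict m M F m<n' M∈ M-shape)
    (subst (λ es → learnA m M ∈ learnSteps P es (red P M)) (sym (reverse-++ (blocks m) (block m)))
      (learnSteps-resolve P (L KT m true) (negClause m) (dec (L KU m true) ∷ dec (L KX m true) ∷ reverse (blocks m)) (red P M)
        (t̄∈red-M m M m<n' M-shape) (learnSteps-head P (reverse (blocks m)) (learnA m M))))
    where open Round round

  M-prefix : ℕ → Clause → Trail
  M-prefix m M = blocks m ++ prop (L KX m false) (learnA m M) ∷ dec (L KU m false) ∷ prop (L KT m true) (posClause m) ∷ []

  M-trail : ℕ → Clause → Trail
  M-trail m M = M-prefix m M ∷ʳ confl M

  module _ (m : ℕ) (F : List Clause) (M : Clause) (m<n' : m < n') (round : Round m F M) where

    open Round round

    private
      m<n = <-trans m<n' n'<n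
      m≤n = <⇒≤ m<n
      A = learnA m M
      A-shape = learnA-shape m M m<n' M-shape
      F′ = F ∷ʳ A

      with-A : ∀ {R : Clause → Set} → (∀ C → C ∈ F → R C) → R A → ∀ C → C ∈ F′ → R C
      with-A {R} onF onA C C∈ = [ onF C , (λ C≡A → subst R (sym C≡A) onA) ]′ (∈-∷ʳ⁻ F C∈)

    legal-x̄-from-A : Legal P F′ (blocks m ++ []) (prop (L KX m false) A)
    legal-x̄-from-A = legal-propagation P (blocks m ++ []) (assigned-++ (blocks m) [])
      (var-free KX m false m [] m<n m≤n ≤-refl []) (isEx-L KX false m<n) (isUn-L KX false m<n) (∈-++⁺ʳ F (here refl))
      (λ y y∈ → unsatisfied y (AClause.shape A-shape y y∈)) (AClause.x̄∈ A-shape)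
      (live KX m false m [] m<n m≤n (inj₂ ≤-refl) []) (λ y y∈ → unit y (AClause.shape A-shape y y∈))
      (λ C C∈ e → no-empty-at-start m (<⇒≤ m<n') (with-A (λ C C∈ → inj₁ (known C C∈)) (inj₂ A-shape) C C∈) e)
      where
      unsatisfied : ∀ y → ALit m y → (y ∈ᴸ (assignment m ++ [])) ≡ false
      unsatisfied y (inj₁ (i , i<m , refl)) = unassigned KT i false m [] (<-trans i<m m<n) m≤n (inj₁ refl) []
      unsatisfied y (inj₂ (inj₁ refl))      = unassigned KX m false m [] m<n m≤n (inj₁ refl) []
      unsatisfied y (inj₂ (inj₂ (i , b , m≤i , i<n , refl))) = unassigned KU i b m [] i<n m≤n (inj₂ m≤i) []
      unit : ∀ y → ALit m y → y ≡ L KX m false ⊎ (neg y ∈ᴸ (assignment m ++ [])) ≡ true ⊎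
               (isUn P y ≡ true × isEx P y ≡ false × lv P (L KX m false) < lv P y)
      unit y (inj₁ (i , i<m , refl)) = inj₂ (inj₁ (sat-assignment KT m [] i<m))
      unit y (inj₂ (inj₁ refl))      = inj₁ refl
      unit y (inj₂ (inj₂ (i , b , m≤i , i<n , refl))) =
        inj₂ (inj₂ (isUn-L KU b i<n , isEx-L KU b i<n , subst₂ _<_ (sym (lv-L KX false m<n)) (sym (lv-L KU b i<n)) 1<2))

    M-conflict : EntryOK P F′ (M-prefix m M) (confl M) []
    M-conflict = conflict-ok P (M-prefix m M) (assigned-++ (blocks m) _) (∈-++⁺ˡ M∈)
      (λ y y∈ → unsatisfied y (MClause.shape M-shape y y∈)) (λ y y∈ → falsified y (MClause.shape M-shape y y∈))
      where
      τ = L KX m false ∷ L KU m false ∷ L KT m true ∷ []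
      unsatisfied : ∀ y → MLit m y → (y ∈ᴸ (assignment m ++ τ)) ≡ false
      unsatisfied y (inj₁ (i , i≤m , refl)) = unassigned KT i false m τ i<n m≤n (inj₁ refl)
        (≢-kind KT i KX m i<n m<n (λ ()) ∷ ≢-kind KT i KU m i<n m<n (λ ()) ∷ ≢-polarity (λ ()) ∷ [])
        where i<n = ≤-<-trans i≤m m<n
      unsatisfied y (inj₂ (i , b , m<i , i<n , refl)) = unassigned KU i b m τ i<n m≤n (inj₂ (<⇒≤ m<i))
        (≢-kind KU i KX m i<n m<n (λ ()) ∷ ≢-index KU i KU m i<n m<n (>⇒≢ m<i) ∷ ≢-kind KU i KT m i<n m<n (λ ()) ∷ [])
      falsified : ∀ y → MLit m y → (neg y ∈ᴸ (assignment m ++ τ)) ≡ true ⊎ (isUn P y ≡ true × isEx P y ≡ false)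
      falsified y (inj₁ (i , i≤m , refl)) with m≤n⇒m<n∨m≡n i≤m
      ... | inj₁ i<m  = inj₁ (sat-assignment KT m τ i<m)
      ... | inj₂ refl = inj₁ (sat-τ m τ (there (there (here refl))))
      falsified y (inj₂ (i , b , m<i , i<n , refl)) = inj₂ (isUn-L KU b i<n , isEx-L KU b i<n)

    M-step : ∀ prev → Step P F′ prev (M-trail m M) (learnM m M)
    M-step prev = conflict-step P (M-prefix m M) prev
      (legal-++ P (blocks m) _ (legal-blocks F′ m (<⇒≤ m<n') known-below (∈-++⁺ˡ ∘ Mat⊆))
        (legalAfter₃ P legal-x̄-from-A
          (legal-u F′ m false (blocks m ++ prop (L KX m false) A ∷ []) m<n' (assigned-++ (blocks m) _) knownX)
          (legal-t F′ m false (blocks m ++ prop (L KX m false) A ∷ dec (L KU m false) ∷ []) m<n'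
            (assigned-++ (blocks m) _) knownX (∈-++⁺ˡ (Mat⊆ (pairClause∈Mat true m<n))))))
      M-conflict
      (subst (λ es → learnM m M ∈ learnSteps P es (red P M)) (sym (reverse-++ (blocks m) _))
        (learnSteps-resolve P (L KT m true) (posClause m) (dec (L KU m false) ∷ prop (L KX m false) A ∷ reverse (blocks m))
          (red P M) (t̄∈red-M m M m<n' M-shape)
          (learnSteps-resolve P (L KX m false) A (reverse (blocks m)) (reduced₁ m M) (x∈reduced₁ m M m<n')
            (learnSteps-head P (reverse (blocks m)) (learnM m M)))))
      where
      known-below : ∀ j → j < m → ∀ C → C ∈ F′ → Known j C
      known-below j j<m = with-A (λ C C∈ → Known-mono (<⇒≤ j<m) (known C C∈)) (known-A m j<m m<n' A-shape)
      knownX : ∀ C → C ∈ F′ → KnownX m false C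
      knownX = with-A (λ C C∈ → inj₁ (known C C∈)) (inj₂ (refl , A-shape))

  next-round : ∀ k F M → suc k < n' → Round (suc k) F M →
    Round k ((F ∷ʳ learnA (suc k) M) ∷ʳ learnM (suc k) M) (learnM (suc k) M)
  next-round k F M k<n' round = record
    { known   = λ C C∈ → [ [ Known-mono (n≤1+n k) ∘ known C , (λ C≡A → subst (Known k) (sym C≡A) known-A′) ]′ ∘ ∈-∷ʳ⁻ F
                         , (λ C≡M → subst (Known k) (sym C≡M) known-M′) ]′ (∈-∷ʳ⁻ (F ∷ʳ _) C∈)
    ; Mat⊆    = ∈-++⁺ˡ ∘ ∈-++⁺ˡ ∘ Mat⊆
    ; M∈      = ∈-++⁺ʳ (F ∷ʳ _) (here refl)
    ; M-shape = learnM-shape k M k<n' M-shape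
    }
    where
    open Round round
    known-A′ : Known k (learnA (suc k) M)
    known-A′ = known-A (suc k) (n<1+n k) k<n' (learnA-shape (suc k) M k<n' M-shape)
    known-M′ : Known k (learnM (suc k) M)
    known-M′ = known-M k ≤-refl (<-trans (n<1+n k) k<n') (learnM-shape k M k<n' M-shape)

  length-blocks-++ : ∀ j R → length (blocks j ++ R) ≡ 3 * j + length R
  length-blocks-++ zero    R = refl
  length-blocks-++ (suc j) R = begin
    length ((blocks j ++ block j) ++ R)   ≡⟨ cong length (++-assoc (blocks j) (block j) R) ⟩
    length (blocks j ++ block j ++ R)     ≡⟨ length-blocks-++ j (block j ++ R) ⟩
    3 * j + (3 + length R)                ≡⟨ sym (+-assoc (3 * j) 3 (length R)) ⟩
    3 * j + 3 + length R                  ≡⟨ cong (_+ length R) (trans (+-comm (3 * j) 3) (sym (*-suc 3 j))) ⟩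
    3 * suc j + length R                  ∎
    where open ≡-Reasoning

  3j+k≤3n : ∀ j d k → k ≤ 3 * d → d + j ≤ n → 3 * j + k ≤ 3 * n
  3j+k≤3n j d k k≤3d d+j≤n = begin
    3 * j + k        ≤⟨ +-monoʳ-≤ (3 * j) k≤3d ⟩
    3 * j + 3 * d    ≡⟨ trans (+-comm (3 * j) (3 * d)) (sym (*-distribˡ-+ 3 d j)) ⟩
    3 * (d + j)      ≤⟨ *-monoʳ-≤ 3 d+j≤n ⟩
    3 * n            ∎
    where open ≤-Reasoning

  length-trail : ∀ j R c → length ((blocks j ++ R) ∷ʳ c) ≡ 3 * j + length (R ∷ʳ c)
  length-trail j R c = trans (cong length (++-assoc (blocks j) R (c ∷ []))) (length-blocks-++ j (R ∷ʳ c))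

  length-first : length (first-prefix ∷ʳ confl (posClause n')) ≤ 3 * n
  length-first rewrite length-trail n' (prop (L KT n' false) tClause ∷ prop (L KX n' false) (negClause n') ∷ []) (confl (posClause n'))
    = 3j+k≤3n n' 1 3 ≤-refl ≤-refl

  length-A : ∀ m M → m < n' → length (A-trail m M) ≤ 3 * n
  length-A m M m<n' rewrite length-blocks-++ (suc m) (confl M ∷ []) = 3j+k≤3n (suc m) 1 1 (s≤s z≤n) (s≤s m<n')

  length-M : ∀ m M → m < n' → length (M-trail m M) ≤ 3 * n
  length-M m M m<n'
    rewrite length-trail m (prop (L KX m false) (learnA m M) ∷ dec (L KU m false) ∷ prop (L KT m true) (posClause m) ∷ []) (confl M)
    = 3j+k≤3n m 2 4 (s≤s (s≤s (s≤s (s≤s z≤n)))) (s≤s m<n')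

  Rounds : ℕ → List Clause → Trail → Set
  Rounds m F prev = Σ[ R ∈ List (Trail × Clause) ] (RefSeq P F (just prev) R × refSize R ≤ suc m * (3 * n + 3 * n))

  two-trails-≤ : ∀ {a c r b X} → a ≤ b → c ≤ b → r ≤ X → a + (c + r) ≤ (b + b) + X
  two-trails-≤ {a} {c} {r} {b} {X} a≤b c≤b r≤X = ≤-trans (+-mono-≤ a≤b (+-mono-≤ c≤b r≤X)) (≤-reflexive (sym (+-assoc b b X)))

  rounds : ∀ m → m < n' → ∀ F M prev → Round m F M → Rounds m F prev
  rounds zero m<n' F M prev round =
    (A-trail 0 M , learnA 0 M) ∷ (M-trail 0 M , learnM 0 M) ∷ [] ,
    (A-step 0 F M (just prev) m<n' round , M-step 0 F M m<n' round (just (A-trail 0 M)) , learnM-zero M m<n' (Round.M-shape round)) ,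
    two-trails-≤ (length-A 0 M m<n') (length-M 0 M m<n') z≤n
  rounds (suc k) k<n' F M prev round =
    prepend (rounds k (<-trans (n<1+n k) k<n') F₂ M₂ (M-trail (suc k) M) (next-round k F M k<n' round))
    where
    M₂ = learnM (suc k) M
    F₂ = (F ∷ʳ learnA (suc k) M) ∷ʳ M₂
    prepend : Rounds k F₂ (M-trail (suc k) M) → Rounds (suc k) F prev
    prepend ([] , () , _)
    prepend (R@(_ ∷ _) , later , size) =
      (A-trail (suc k) M , learnA (suc k) M) ∷ (M-trail (suc k) M , M₂) ∷ R ,
      (A-step (suc k) F M (just prev) k<n' round , M-step (suc k) F M k<n' round (just (A-trail (suc k) M)) , later) ,
      two-trails-≤ (length-A (suc k) M k<n') (length-M (suc k) M k<n') size

  first-trail : Trail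
  first-trail = first-prefix ∷ʳ confl (posClause n')

  Refutation : Set
  Refutation = Σ[ R ∈ List (Trail × Clause) ] (RefSeq P Mat nothing R × refSize R ≤ 3 * n + n' * (3 * n + 3 * n))

  refutation-single : 0 ≡ n' → Refutation
  refutation-single 0≡n' = (first-trail , Mtop) ∷ [] , (first-step , Mtop-zero 0≡n') ,
    ≤-trans (≤-reflexive (+-identityʳ _)) (≤-trans length-first (m≤m+n _ _))

  refutation-rounds : ∀ k → suc k ≡ n' → Refutation
  refutation-rounds k 1+k≡n' = prepend (rounds k k<n' (Mat ∷ʳ Mtop) Mtop first-trail initial-round)
    where
    k<n' : k < n'
    k<n' = ≤-reflexive 1+k≡n'
    initial-round : Round k (Mat ∷ʳ Mtop) Mtop
    initial-round = record
      { known   = λ C C∈ → [ Mat-known , (λ C≡M → subst (Known k) (sym C≡M) (known-M k ≤-refl k<n' (Mtop-shape k 1+k≡n'))) ]′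
                             (∈-∷ʳ⁻ Mat C∈)
      ; Mat⊆    = ∈-++⁺ˡ
      ; M∈      = ∈-++⁺ʳ Mat (here refl)
      ; M-shape = Mtop-shape k 1+k≡n'
      }
    prepend : Rounds k (Mat ∷ʳ Mtop) first-trail → Refutation
    prepend ([] , () , _)
    prepend (R@(_ ∷ _) , later , size) =
      (first-trail , Mtop) ∷ R , (first-step , later) ,
      +-mono-≤ length-first (subst (λ j → refSize R ≤ j * (3 * n + 3 * n)) 1+k≡n' size)

zero-or-suc : ∀ n → 0 ≡ n ⊎ Σ[ k ∈ ℕ ] suc k ≡ n
zero-or-suc zero    = inj₁ refl
zero-or-suc (suc k) = inj₂ (k , refl)

-- Equality 0 contains the empty clause, so a single conflict refutes it.
refutation-zero : IsRefutation (Equality 0) ((confl [] ∷ [] , []) ∷ [])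
refutation-zero =
  conflict-step P [] nothing (legal-[] P) (conflict-ok P [] refl (here refl) (λ _ ()) (λ _ ())) (learnSteps-head P [] []) ,
  refl
  where P = prefix (Equality 0)

six-n² : ∀ N → N * (3 * N + 3 * N) ≡ 6 * N ^ 2
six-n² = solve 1 (λ N → N :* (con 3 :* N :+ con 3 :* N) := con 6 :* (N :^ 2)) refl
  where open +-*-Solver

size-bound : ∀ n' → 3 * suc n' + n' * (3 * suc n' + 3 * suc n') ≤ 6 * suc n' ^ 2 + 6
size-bound n' = ≤-trans (+-monoˡ-≤ _ (m≤m+n (3 * suc n') (3 * suc n'))) (≤-trans (≤-reflexive (six-n² (suc n'))) (m≤m+n _ 6))

-- Splitting through zero-or-suc keeps n' abstract; matching n' against constructors would make Agda
-- normalise the concrete instances of the whole development.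
equality-refutation : ∀ n' → Trails.Refutation n'
equality-refutation n' with zero-or-suc n'
... | inj₁ 0≡n'         = Trails.refutation-single n' 0≡n'
... | inj₂ (k , 1+k≡n') = Trails.refutation-rounds n' k 1+k≡n'

proposition8p5 : Σ[ c ∈ ℕ ] Σ[ k ∈ ℕ ] ((n : ℕ) →
    Σ[ R ∈ List (Trail × Clause) ] (IsRefutation (Equality n) R × refSize R ≤ c * n ^ k + c))
proposition8p5 = 6 , 2 , refutation
  where
  refutation : (n : ℕ) → Σ[ R ∈ List (Trail × Clause) ] (IsRefutation (Equality n) R × refSize R ≤ 6 * n ^ 2 + 6)
  refutation zero     = (confl [] ∷ [] , []) ∷ [] , refutation-zero , s≤s z≤n
  refutation (suc n') =
    let R , refutes , size = equality-refutation n' in R , refutes , ≤-trans size (size-bound n')
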